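{- $\dim_{\mathbb Q}\mathrm{FSh}_2(N)=0$ if $N$ is even, and $\dim_{\mathbb Q}\mathrm{FSh}_2(N)=\left\lfloor \frac N3 \right\rfloor+1$ if $N$ is odd.
   Context: For $N \geq 0$, let $V'_N=\{f \in \mathbb Q(X,Y)_{N-2} \mid XY\cdot f \in \mathbb Q[X,Y]\}$ be the space of rational functions homogeneous of degree $N-2$ with at most simple poles along $X=0$ and $Y=0$ and no other poles. The length two Fay-shuffle space $\mathrm{FSh}_2(N)$ is the set of $P \in V'_N$ satisfying $P(X,Y)+P(X+Y,-Y)+P(-X-Y,X)=0$ and $P(X,Y)+P(Y,X)=0$. -}

module Defs where

open import Data.Nat as ℕ using (ℕ; zero; suc; _∸_)
open import Data.Fin using (Fin; toℕ)
open import Data.Vec using (Vec; []; _∷_; tabulate; lookup; zipWith; replicate; foldr)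
open import Data.Rational using (ℚ; 0ℚ; 1ℚ; _+_; _*_; -_; 1/_; ≢-nonZero)
open import Data.Rational.Properties using (_≟_)
open import Data.Product using (Σ; _×_; ∃)
open import Relation.Nullary using (yes; no)
open import Relation.Binary.PropositionalEquality using (_≡_; _≢_)

pow : ℚ → ℕ → ℚ
pow x zero    = 1ℚ
pow x (suc k) = x * pow x k

-- total inverse (value 0 at 0); only ever used at nonzero arguments below
inv : ℚ → ℚ
inv p with p ≟ 0ℚ
... | yes _  = 0ℚ
... | no p≢0 = 1/_ p {{≢-nonZero p≢0}}

Σℚ : ∀ {n} → Vec ℚ n → ℚ
Σℚ = foldr _ _+_ 0ℚ

-- Every f ∈ V'_N is uniquely f = g / (X Y) with g homogeneous of degree N
-- in ℚ[X,Y]; we encode f by the coefficient vector c ∈ ℚ^(N+1) of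
-- g = Σ_{i=0}^{N} c_i X^i Y^(N-i).  This is a ℚ-linear isomorphism
-- V'_N ≅ ℚ^(N+1).

V′ : ℕ → Set
V′ N = Vec ℚ (suc N)

numer : ∀ N → V′ N → ℚ → ℚ → ℚ
numer N c x y = Σℚ (tabulate (λ (i : Fin (suc N)) →
  lookup c i * (pow x (toℕ i) * pow y (N ∸ toℕ i))))

evalP : ∀ N → V′ N → ℚ → ℚ → ℚ
evalP N c x y = numer N c x y * inv (x * y)

-- Fay-shuffle relations, as identities of functions away from the poles
-- (equivalent to identities of rational functions since ℚ is infinite)
IsFSh₂ : ∀ N → V′ N → Set
IsFSh₂ N P =
  (∀ x y → x ≢ 0ℚ → y ≢ 0ℚ → x + y ≢ 0ℚ →
     evalP N P x y + evalP N P (x + y) (- y) + evalP N P (- x + - y) x ≡ 0ℚ)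
  × (∀ x y → x ≢ 0ℚ → y ≢ 0ℚ → evalP N P x y + evalP N P y x ≡ 0ℚ)

zeroV : ∀ n → Vec ℚ n
zeroV n = replicate n 0ℚ

_⊕_ : ∀ {n} → Vec ℚ n → Vec ℚ n → Vec ℚ n
_⊕_ = zipWith _+_

_⊙_ : ∀ {n} → ℚ → Vec ℚ n → Vec ℚ n
a ⊙ v = Data.Vec.map (a *_) v

linComb : ∀ {n d} → Vec ℚ d → Vec (Vec ℚ n) d → Vec ℚ n
linComb {n} []       []       = zeroV n
linComb     (a ∷ as) (v ∷ vs) = (a ⊙ v) ⊕ linComb as vs

LinIndep : ∀ {n d} → Vec (Vec ℚ n) d → Set
LinIndep {n} {d} vs = ∀ (a : Vec ℚ d) → linComb a vs ≡ zeroV n → a ≡ zeroV d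

IsBasis : ∀ {n d} → (Vec ℚ n → Set) → Vec (Vec ℚ n) d → Set
IsBasis {n} {d} S vs =
  (∀ (j : Fin d) → S (lookup vs j))
  × LinIndep vs
  × (∀ v → S v → ∃ λ (a : Vec ℚ d) → linComb a vs ≡ v)

HasDim : ∀ {n} → (Vec ℚ n → Set) → ℕ → Set
HasDim {n} S d = ∃ λ (vs : Vec (Vec ℚ n) d) → IsBasis S vs

module Submission where

-- Write P = g/(XY) with g homogeneous of degree N, so that g(t,1) is a polynomial of degree ≤ N.
-- For even N, P(−x,−y) = P(x,y), and the Fay relations at (x,y) and (−x−y,x) together with
-- antisymmetry force P = 0.  For odd N put m = ⌊N/3⌋.  W = (xy(x+y))² and Q = x² + xy + y² are
-- invariant under (x,y) ↦ (x+y,−y), (−x−y,x), (y,x), and B₀ = y − x, B₁ = xy(y − x) are solutions,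
-- so each W^b Q^a B_r of degree N is a solution; its lowest power of x is x^(2b+r), which realises
-- every j ≤ m.  Conversely a solution divisible by x^(m+1) is also divisible by y^(m+1), by x − y and
-- by (x + y)^m, of total degree 3m + 3 > N, so it vanishes.  Hence the m + 1 solutions form an
-- echelon basis.

open import Defs

module RationalArithmetic where

  open import Data.Empty using (⊥-elim)
  open import Data.Nat as ℕ using (ℕ; zero; suc)
  import Data.Nat.Properties as ℕ
  open import Data.Rational using (0ℚ; 1ℚ; _+_; _*_; -_; _-_; _<_; ≢-nonZero)
  open import Data.Rational.Properties
  open import Data.Rational.Solver using (module +-*-Solver)
  open import Relation.Binary.PropositionalEquality
  open import Relation.Nullary using (yes; no)
  open +-*-Solver using (solve; _:=_; _:+_; _:*_; _:-_; :-_; con)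

  inv-inverseˡ : ∀ p → p ≢ 0ℚ → inv p * p ≡ 1ℚ
  inv-inverseˡ p p≢0 with p ≟ 0ℚ
  ... | yes p≡0 = ⊥-elim (p≢0 p≡0)
  ... | no p≢0′ = *-inverseˡ p {{≢-nonZero p≢0′}}

  p*q≡0⇒q≡0 : ∀ p q → p ≢ 0ℚ → p * q ≡ 0ℚ → q ≡ 0ℚ
  p*q≡0⇒q≡0 p q p≢0 pq≡0 = begin
    q                ≡⟨ sym (*-identityˡ q) ⟩
    1ℚ * q           ≡⟨ cong (_* q) (sym (inv-inverseˡ p p≢0)) ⟩
    (inv p * p) * q  ≡⟨ *-assoc (inv p) p q ⟩
    inv p * (p * q)  ≡⟨ cong (inv p *_) pq≡0 ⟩
    inv p * 0ℚ       ≡⟨ *-zeroʳ (inv p) ⟩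
    0ℚ               ∎
    where open ≡-Reasoning

  *-inv-cancelˡ : ∀ d e → d ≢ 0ℚ → d * e * inv d ≡ e
  *-inv-cancelˡ d e d≢0 = begin
    d * e * inv d      ≡⟨ solve 3 (λ d e i → d :* e :* i := (i :* d) :* e) refl d e (inv d) ⟩
    (inv d * d) * e    ≡⟨ cong (_* e) (inv-inverseˡ d d≢0) ⟩
    1ℚ * e             ≡⟨ *-identityˡ e ⟩
    e                  ∎
    where open ≡-Reasoning

  p*q≡0⇒p≡0 : ∀ p q → q ≢ 0ℚ → p * q ≡ 0ℚ → p ≡ 0ℚ
  p*q≡0⇒p≡0 p q q≢0 pq≡0 = p*q≡0⇒q≡0 q p q≢0 (trans (*-comm q p) pq≡0)

  p*q≢0 : ∀ p q → p ≢ 0ℚ → q ≢ 0ℚ → p * q ≢ 0ℚ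
  p*q≢0 p q p≢0 q≢0 pq≡0 = q≢0 (p*q≡0⇒q≡0 p q p≢0 pq≡0)

  inv≢0 : ∀ p → p ≢ 0ℚ → inv p ≢ 0ℚ
  inv≢0 p p≢0 i≡0 = 1≢0 (trans (sym (inv-inverseˡ p p≢0)) (trans (cong (_* p) i≡0) (*-zeroˡ p)))

  -p≢0 : ∀ p → p ≢ 0ℚ → - p ≢ 0ℚ
  -p≢0 p p≢0 -p≡0 = p≢0 (neg-injective -p≡0)

  -x-y≢0 : ∀ x y → x + y ≢ 0ℚ → - x + - y ≢ 0ℚ
  -x-y≢0 x y x+y≢0 e = x+y≢0 (trans (solve 2 (λ x y → x :+ y := :- (:- x :+ :- y)) refl x y) (cong -_ e))

  p-q≡0⇒p≡q : ∀ p q → p - q ≡ 0ℚ → p ≡ q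
  p-q≡0⇒p≡q p q p-q≡0 = begin
    p            ≡⟨ solve 2 (λ p q → p := (p :- q) :+ q) refl p q ⟩
    (p - q) + q  ≡⟨ cong (_+ q) p-q≡0 ⟩
    0ℚ + q       ≡⟨ +-identityˡ q ⟩
    q            ∎
    where open ≡-Reasoning

  p+q≡0⇒p≡-q : ∀ p q → p + q ≡ 0ℚ → p ≡ - q
  p+q≡0⇒p≡-q p q p+q≡0 = begin
    p            ≡⟨ solve 2 (λ p q → p := (p :+ q) :- q) refl p q ⟩
    (p + q) - q  ≡⟨ cong (_- q) p+q≡0 ⟩
    0ℚ - q       ≡⟨ +-identityˡ (- q) ⟩
    - q          ∎
    where open ≡-Reasoning

  p+p≡0⇒p≡0 : ∀ p → p + p ≡ 0ℚ → p ≡ 0ℚ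
  p+p≡0⇒p≡0 p p+p≡0 = p*q≡0⇒q≡0 (1ℚ + 1ℚ) p (λ ())
    (trans (solve 1 (λ p → (con 1ℚ :+ con 1ℚ) :* p := p :+ p) refl p) p+p≡0)

  *-cancelˡ-≢0 : ∀ p q r → p ≢ 0ℚ → p * q ≡ p * r → q ≡ r
  *-cancelˡ-≢0 p q r p≢0 pq≡pr = p-q≡0⇒p≡q q r (p*q≡0⇒q≡0 p (q - r) p≢0 (begin
    p * (q - r)        ≡⟨ solve 3 (λ p q r → p :* (q :- r) := p :* q :- p :* r) refl p q r ⟩
    p * q - p * r      ≡⟨ cong (_- p * r) pq≡pr ⟩
    p * r - p * r      ≡⟨ +-inverseʳ (p * r) ⟩
    0ℚ                 ∎))
    where open ≡-Reasoning

  p<q⇒q-p≢0 : ∀ {p q} → p < q → q - p ≢ 0ℚ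
  p<q⇒q-p≢0 {p} {q} p<q q-p≡0 = <⇒≢ p<q (sym (p-q≡0⇒p≡q q p q-p≡0))

  0<p⇒p≢0 : ∀ {p} → 0ℚ < p → p ≢ 0ℚ
  0<p⇒p≢0 0<p p≡0 = <⇒≢ 0<p (sym p≡0)

  p<p+1 : ∀ p → p < p + 1ℚ
  p<p+1 p = subst (_< p + 1ℚ) (+-identityʳ p) (+-monoʳ-< p (positive⁻¹ 1ℚ))

  pow≢0 : ∀ p n → p ≢ 0ℚ → pow p n ≢ 0ℚ
  pow≢0 p zero    p≢0 = 1≢0
  pow≢0 p (suc n) p≢0 = p*q≢0 p (pow p n) p≢0 (pow≢0 p n p≢0)

  pow-1ℚ : ∀ n → pow 1ℚ n ≡ 1ℚ
  pow-1ℚ zero    = refl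
  pow-1ℚ (suc n) = trans (*-identityˡ (pow 1ℚ n)) (pow-1ℚ n)

  pow-distribʳ-* : ∀ p q n → pow (p * q) n ≡ pow p n * pow q n
  pow-distribʳ-* p q zero    = refl
  pow-distribʳ-* p q (suc n) = trans (cong ((p * q) *_) (pow-distribʳ-* p q n))
    (solve 4 (λ p q u v → (p :* q) :* (u :* v) := (p :* u) :* (q :* v)) refl p q (pow p n) (pow q n))

  pow-distribˡ-+-* : ∀ p m n → pow p (m ℕ.+ n) ≡ pow p m * pow p n
  pow-distribˡ-+-* p zero    n = sym (*-identityˡ (pow p n))
  pow-distribˡ-+-* p (suc m) n = trans (cong (p *_) (pow-distribˡ-+-* p m n))
    (sym (*-assoc p (pow p m) (pow p n)))

  pow-*-assoc : ∀ p m n → pow (pow p m) n ≡ pow p (m ℕ.* n)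
  pow-*-assoc p m zero    = cong (pow p) (sym (ℕ.*-zeroʳ m))
  pow-*-assoc p m (suc n) = begin
    pow p m * pow (pow p m) n  ≡⟨ cong (pow p m *_) (pow-*-assoc p m n) ⟩
    pow p m * pow p (m ℕ.* n)  ≡⟨ sym (pow-distribˡ-+-* p m (m ℕ.* n)) ⟩
    pow p (m ℕ.+ m ℕ.* n)      ≡⟨ cong (pow p) (sym (ℕ.*-suc m n)) ⟩
    pow p (m ℕ.* suc n)        ∎
    where open ≡-Reasoning

module Polynomials where

  open import Data.Fin using (Fin; toℕ) renaming (zero to fzero; suc to fsuc)
  open import Data.List using (List; []; _∷_; length; map)
  open import Data.List.Properties using (length-map)
  open import Data.Nat as ℕ using (ℕ; zero; suc; z≤n; s≤s)
  import Data.Nat.Properties as ℕ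
  open import Data.Product using (∃; _×_; _,_; proj₁; proj₂)
  open import Data.Rational using (ℚ; 0ℚ; 1ℚ; _+_; _*_; -_; _-_; _<_; _≤_)
  open import Data.Rational.Properties
  open import Data.Rational.Solver using (module +-*-Solver)
  open import Data.Vec using (Vec; []; _∷_; lookup; toList)
  open import Relation.Binary.PropositionalEquality
  open +-*-Solver using (solve; _:=_; _:+_; _:*_; _:-_; :-_; con)
  open RationalArithmetic

  eval : List ℚ → ℚ → ℚ
  eval []      t = 0ℚ
  eval (c ∷ p) t = c + t * eval p t

  infixl 6 _+ₚ_
  infixl 7 _*ₚ_ _•ₚ_
  infixr 8 _^ₚ_

  _+ₚ_ : List ℚ → List ℚ → List ℚ
  []      +ₚ q       = q
  (c ∷ p) +ₚ []      = c ∷ p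
  (c ∷ p) +ₚ (d ∷ q) = (c + d) ∷ (p +ₚ q)

  _•ₚ_ : ℚ → List ℚ → List ℚ
  a •ₚ p = map (a *_) p

  _*ₚ_ : List ℚ → List ℚ → List ℚ
  []      *ₚ q = []
  (c ∷ p) *ₚ q = c •ₚ q +ₚ (0ℚ ∷ p *ₚ q)

  _^ₚ_ : List ℚ → ℕ → List ℚ
  p ^ₚ zero  = 1ℚ ∷ []
  p ^ₚ suc k = p *ₚ p ^ₚ k

  eval-+ₚ : ∀ p q t → eval (p +ₚ q) t ≡ eval p t + eval q t
  eval-+ₚ []      q       t = sym (+-identityˡ _)
  eval-+ₚ (c ∷ p) []      t = sym (+-identityʳ _)
  eval-+ₚ (c ∷ p) (d ∷ q) t = trans (cong (λ u → (c + d) + t * u) (eval-+ₚ p q t))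
    (solve 5 (λ c d t u v → (c :+ d) :+ t :* (u :+ v) := (c :+ t :* u) :+ (d :+ t :* v))
       refl c d t (eval p t) (eval q t))

  eval-•ₚ : ∀ a p t → eval (a •ₚ p) t ≡ a * eval p t
  eval-•ₚ a []      t = sym (*-zeroʳ a)
  eval-•ₚ a (c ∷ p) t = trans (cong (λ u → a * c + t * u) (eval-•ₚ a p t))
    (solve 4 (λ a c t u → a :* c :+ t :* (a :* u) := a :* (c :+ t :* u)) refl a c t (eval p t))

  eval-*ₚ : ∀ p q t → eval (p *ₚ q) t ≡ eval p t * eval q t
  eval-*ₚ []      q t = sym (*-zeroˡ (eval q t))
  eval-*ₚ (c ∷ p) q t = begin
    eval (c •ₚ q +ₚ (0ℚ ∷ p *ₚ q)) t
      ≡⟨ eval-+ₚ (c •ₚ q) (0ℚ ∷ p *ₚ q) t ⟩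
    eval (c •ₚ q) t + (0ℚ + t * eval (p *ₚ q) t)
      ≡⟨ cong₂ (λ u v → u + (0ℚ + t * v)) (eval-•ₚ c q t) (eval-*ₚ p q t) ⟩
    c * eval q t + (0ℚ + t * (eval p t * eval q t))
      ≡⟨ solve 4 (λ c v t u → c :* v :+ (con 0ℚ :+ t :* (u :* v)) := (c :+ t :* u) :* v)
           refl c (eval q t) t (eval p t) ⟩
    (c + t * eval p t) * eval q t  ∎
    where open ≡-Reasoning

  eval-^ₚ : ∀ p k t → eval (p ^ₚ k) t ≡ pow (eval p t) k
  eval-^ₚ p zero    t = trans (cong (1ℚ +_) (*-zeroʳ t)) (+-identityʳ 1ℚ)
  eval-^ₚ p (suc k) t = trans (eval-*ₚ p (p ^ₚ k) t) (cong (eval p t *_) (eval-^ₚ p k t))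

  length-+ₚ : ∀ {n} p q → length p ℕ.≤ n → length q ℕ.≤ n → length (p +ₚ q) ℕ.≤ n
  length-+ₚ []      q       _         q≤n       = q≤n
  length-+ₚ (c ∷ p) []      p≤n       _         = p≤n
  length-+ₚ (c ∷ p) (d ∷ q) (s≤s p≤n) (s≤s q≤n) = s≤s (length-+ₚ p q p≤n q≤n)

  length-•ₚ : ∀ a p → length (a •ₚ p) ≡ length p
  length-•ₚ a p = length-map (a *_) p

  length-*ₚ : ∀ {d e} p q → length p ℕ.≤ suc d → length q ℕ.≤ suc e →
              length (p *ₚ q) ℕ.≤ suc (d ℕ.+ e)
  length-*ₚ []          q _ _ = z≤n
  length-*ₚ {d} {e} (c ∷ []) q _ q≤1+e = length-+ₚ (c •ₚ q) (0ℚ ∷ [])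
    (subst (ℕ._≤ suc (d ℕ.+ e)) (sym (length-•ₚ c q)) (ℕ.≤-trans q≤1+e (s≤s (ℕ.m≤n+m e d))))
    (s≤s z≤n)
  length-*ₚ {suc d} {e} (c ∷ p@(_ ∷ _)) q (s≤s p≤1+d) q≤1+e = length-+ₚ (c •ₚ q) (0ℚ ∷ p *ₚ q)
    (subst (ℕ._≤ suc (suc d ℕ.+ e)) (sym (length-•ₚ c q)) (ℕ.≤-trans q≤1+e (s≤s (ℕ.m≤n+m e (suc d)))))
    (s≤s (length-*ₚ p q p≤1+d q≤1+e))

  length-^ₚ : ∀ {d} p k → length p ℕ.≤ suc d → length (p ^ₚ k) ℕ.≤ suc (k ℕ.* d)
  length-^ₚ p zero    _      = s≤s z≤n
  length-^ₚ p (suc k) p≤1+d = length-*ₚ p (p ^ₚ k) p≤1+d (length-^ₚ p k p≤1+d)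

  Polynomial : (ℚ → ℚ) → Set
  Polynomial F = ∃ λ p → F ≗ eval p

  Polynomial< : ℕ → (ℚ → ℚ) → Set
  Polynomial< n F = ∃ λ p → length p ℕ.≤ n × F ≗ eval p

  polynomial-const : ∀ c → Polynomial (λ _ → c)
  polynomial-const c = c ∷ [] , λ t → solve 2 (λ c t → c := c :+ t :* con 0ℚ) refl c t

  polynomial-id : Polynomial (λ t → t)
  polynomial-id = 0ℚ ∷ 1ℚ ∷ [] ,
    λ t → solve 1 (λ t → t := con 0ℚ :+ t :* (con 1ℚ :+ t :* con 0ℚ)) refl t

  polynomial-+ : ∀ {F G} → Polynomial F → Polynomial G → Polynomial (λ t → F t + G t)
  polynomial-+ (p , F≗p) (q , G≗q) = p +ₚ q ,
    λ t → trans (cong₂ _+_ (F≗p t) (G≗q t)) (sym (eval-+ₚ p q t))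

  polynomial-* : ∀ {F G} → Polynomial F → Polynomial G → Polynomial (λ t → F t * G t)
  polynomial-* (p , F≗p) (q , G≗q) = p *ₚ q ,
    λ t → trans (cong₂ _*_ (F≗p t) (G≗q t)) (sym (eval-*ₚ p q t))

  polynomial-neg : ∀ {F} → Polynomial F → Polynomial (λ t → - F t)
  polynomial-neg {F} (p , F≗p) = - 1ℚ •ₚ p , λ t → begin
    - F t             ≡⟨ cong -_ (F≗p t) ⟩
    - eval p t        ≡⟨ solve 1 (λ u → :- u := (:- con 1ℚ) :* u) refl (eval p t) ⟩
    - 1ℚ * eval p t   ≡⟨ sym (eval-•ₚ (- 1ℚ) p t) ⟩
    eval (- 1ℚ •ₚ p) t ∎
    where open ≡-Reasoning

  polynomial-pow : ∀ {F} k → Polynomial F → Polynomial (λ t → pow (F t) k)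
  polynomial-pow k (p , F≗p) = p ^ₚ k ,
    λ t → trans (cong (λ u → pow u k) (F≗p t)) (sym (eval-^ₚ p k t))

  polynomial<⇒polynomial : ∀ {n F} → Polynomial< n F → Polynomial F
  polynomial<⇒polynomial (p , _ , F≗p) = p , F≗p

  polynomial<-mono : ∀ {m n F} → m ℕ.≤ n → Polynomial< m F → Polynomial< n F
  polynomial<-mono m≤n (p , p≤m , F≗p) = p , ℕ.≤-trans p≤m m≤n , F≗p

  polynomial<-cong : ∀ {n F G} → F ≗ G → Polynomial< n F → Polynomial< n G
  polynomial<-cong F≗G (p , p≤n , F≗p) = p , p≤n , λ t → trans (sym (F≗G t)) (F≗p t)

  polynomial<-+ : ∀ {n F G} → Polynomial< n F → Polynomial< n G → Polynomial< n (λ t → F t + G t)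
  polynomial<-+ (p , p≤n , F≗p) (q , q≤n , G≗q) = p +ₚ q , length-+ₚ p q p≤n q≤n ,
    λ t → trans (cong₂ _+_ (F≗p t) (G≗q t)) (sym (eval-+ₚ p q t))

  polynomial<-monomial : ∀ c d → Polynomial< (suc d) (λ t → c * pow t d)
  polynomial<-monomial c zero    = c ∷ [] , s≤s z≤n ,
    λ t → solve 2 (λ c t → c :* con 1ℚ := c :+ t :* con 0ℚ) refl c t
  polynomial<-monomial c (suc d) with polynomial<-monomial c d
  ... | p , p≤1+d , ctᵈ≗p = 0ℚ ∷ p , s≤s p≤1+d , λ t →
    trans (solve 3 (λ c t u → c :* (t :* u) := con 0ℚ :+ t :* (c :* u)) refl c t (pow t d))
          (cong (λ u → 0ℚ + t * u) (ctᵈ≗p t))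

  polynomial<0⇒zero : ∀ {F} → Polynomial< 0 F → ∀ t → F t ≡ 0ℚ
  polynomial<0⇒zero ([] , _ , F≗0) = F≗0

  quotient : ℚ → List ℚ → List ℚ
  quotient a []          = []
  quotient a (c ∷ [])    = []
  quotient a (c ∷ d ∷ p) = eval (d ∷ p) a ∷ quotient a (d ∷ p)

  eval-quotient : ∀ a p t → eval p t ≡ (t - a) * eval (quotient a p) t + eval p a
  eval-quotient a []          t = solve 2 (λ t a → con 0ℚ := (t :- a) :* con 0ℚ :+ con 0ℚ) refl t a
  eval-quotient a (c ∷ [])    t =
    solve 3 (λ c t a → c :+ t :* con 0ℚ := (t :- a) :* con 0ℚ :+ (c :+ a :* con 0ℚ)) refl c t a
  eval-quotient a (c ∷ d ∷ p) t = trans (cong (λ u → c + t * u) (eval-quotient a (d ∷ p) t))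
    (solve 5 (λ c t a q r → c :+ t :* ((t :- a) :* q :+ r) := (t :- a) :* (r :+ t :* q) :+ (c :+ a :* r))
       refl c t a (eval (quotient a (d ∷ p)) t) (eval (d ∷ p) a))

  length-quotient : ∀ a p → length (quotient a p) ≡ ℕ.pred (length p)
  length-quotient a []          = refl
  length-quotient a (c ∷ [])    = refl
  length-quotient a (c ∷ d ∷ p) = cong suc (length-quotient a (d ∷ p))

  factor-root : ∀ {n} a {F} → Polynomial< (suc n) F → F a ≡ 0ℚ →
                ∃ λ F′ → Polynomial< n F′ × (∀ t → F t ≡ (t - a) * F′ t)
  factor-root {n} a {F} (p , p≤1+n , F≗p) Fa≡0 = eval (quotient a p) ,
    (quotient a p , subst (ℕ._≤ n) (sym (length-quotient a p)) (ℕ.pred-mono-≤ p≤1+n) , λ _ → refl) ,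
    λ t → begin
      F t                                         ≡⟨ F≗p t ⟩
      eval p t                                    ≡⟨ eval-quotient a p t ⟩
      (t - a) * eval (quotient a p) t + eval p a  ≡⟨ cong ((t - a) * eval (quotient a p) t +_) (trans (sym (F≗p a)) Fa≡0) ⟩
      (t - a) * eval (quotient a p) t + 0ℚ        ≡⟨ +-identityʳ _ ⟩
      (t - a) * eval (quotient a p) t             ∎
    where open ≡-Reasoning

  -- Divide by t − (c + 1): the quotient vanishes beyond c + 1 and is shorter.
  eval-ray-zero⇒zero : ∀ n p → length p ℕ.≤ n → ∀ c → (∀ t → c < t → eval p t ≡ 0ℚ) →
                       ∀ t → eval p t ≡ 0ℚ
  eval-ray-zero⇒zero zero    []    _     c _ t = refl
  eval-ray-zero⇒zero (suc n) p p≤1+n c p>c≡0 t = begin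
    eval p t                                   ≡⟨ eval-quotient b p t ⟩
    (t - b) * eval (quotient b p) t + eval p b ≡⟨ cong₂ (λ u v → (t - b) * u + v) (q≡0 t) (p>c≡0 b (p<p+1 c)) ⟩
    (t - b) * 0ℚ + 0ℚ                          ≡⟨ solve 2 (λ t b → (t :- b) :* con 0ℚ :+ con 0ℚ := con 0ℚ) refl t b ⟩
    0ℚ                                         ∎
    where
    open ≡-Reasoning
    b = c + 1ℚ
    q>b≡0 : ∀ s → b < s → eval (quotient b p) s ≡ 0ℚ
    q>b≡0 s b<s = p*q≡0⇒q≡0 (s - b) _ (p<q⇒q-p≢0 b<s) (begin
      (s - b) * eval (quotient b p) s           ≡⟨ sym (+-identityʳ _) ⟩
      (s - b) * eval (quotient b p) s + 0ℚ      ≡⟨ cong ((s - b) * eval (quotient b p) s +_) (sym (p>c≡0 b (p<p+1 c))) ⟩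
      (s - b) * eval (quotient b p) s + eval p b ≡⟨ sym (eval-quotient b p s) ⟩
      eval p s                                  ≡⟨ p>c≡0 s (<-trans (p<p+1 c) b<s) ⟩
      0ℚ                                        ∎)
    q≡0 : ∀ t → eval (quotient b p) t ≡ 0ℚ
    q≡0 = eval-ray-zero⇒zero n (quotient b p)
            (subst (ℕ._≤ n) (sym (length-quotient b p)) (ℕ.pred-mono-≤ p≤1+n)) b q>b≡0

  polynomial-ray-zero⇒zero : ∀ {F} → Polynomial F → ∀ c → (∀ t → c < t → F t ≡ 0ℚ) → ∀ t → F t ≡ 0ℚ
  polynomial-ray-zero⇒zero (p , F≗p) c F>c≡0 t = trans (F≗p t)
    (eval-ray-zero⇒zero (length p) p ℕ.≤-refl c (λ s c<s → trans (sym (F≗p s)) (F>c≡0 s c<s)) t)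

  ray-zero⇒zeroV : ∀ {n} (v : Vec ℚ n) c → (∀ t → c < t → eval (toList v) t ≡ 0ℚ) → v ≡ zeroV n
  ray-zero⇒zeroV []      c _     = refl
  ray-zero⇒zeroV (a ∷ v) c v>c≡0 = cong₂ _∷_ a≡0 (ray-zero⇒zeroV v 0ℚ tail>0≡0)
    where
    v≡0 : ∀ t → a + t * eval (toList v) t ≡ 0ℚ
    v≡0 = eval-ray-zero⇒zero _ (toList (a ∷ v)) ℕ.≤-refl c v>c≡0
    a≡0 : a ≡ 0ℚ
    a≡0 = trans (sym (trans (cong (a +_) (*-zeroˡ (eval (toList v) 0ℚ))) (+-identityʳ a))) (v≡0 0ℚ)
    tail>0≡0 : ∀ t → 0ℚ < t → eval (toList v) t ≡ 0ℚ
    tail>0≡0 t 0<t = p*q≡0⇒q≡0 t _ (0<p⇒p≢0 0<t)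
      (trans (sym (+-identityˡ _)) (trans (cong (λ u → u + t * eval (toList v) t) (sym a≡0)) (v≡0 t)))

  power-factor-root : ∀ k a c {A G F : ℚ → ℚ} → Polynomial A → Polynomial G → Polynomial F → A a ≢ 0ℚ →
                      (∀ t → c < t → A t * F t ≡ pow (t - a) (suc k) * G t) → F a ≡ 0ℚ
  power-factor-root k a c {A} {G} {F} A-poly G-poly F-poly Aa≢0 AF≡ = p*q≡0⇒q≡0 (A a) (F a) Aa≢0 (begin
    A a * F a
      ≡⟨ solve 3 (λ u v w → u := u :- (con 0ℚ :* v) :* w) refl (A a * F a) (pow (a - a) k) (G a) ⟩
    A a * F a - (0ℚ * pow (a - a) k) * G a
      ≡⟨ cong (λ u → A a * F a - (u * pow (a - a) k) * G a) (sym (+-inverseʳ a)) ⟩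
    A a * F a - pow (a - a) (suc k) * G a
      ≡⟨ H≡0 a ⟩
    0ℚ ∎)
    where
    open ≡-Reasoning
    H-poly : Polynomial (λ t → A t * F t - pow (t - a) (suc k) * G t)
    H-poly = polynomial-+ (polynomial-* A-poly F-poly) (polynomial-neg (polynomial-*
      (polynomial-pow (suc k) (polynomial-+ polynomial-id (polynomial-const (- a)))) G-poly))
    H≡0 : ∀ t → A t * F t - pow (t - a) (suc k) * G t ≡ 0ℚ
    H≡0 = polynomial-ray-zero⇒zero H-poly c λ t c<t →
      trans (cong (_- pow (t - a) (suc k) * G t) (AF≡ t c<t)) (+-inverseʳ (pow (t - a) (suc k) * G t))

  cancel-linear-factor : ∀ k a c {A G F F₁ : ℚ → ℚ} → a ≤ c → (∀ t → F t ≡ (t - a) * F₁ t) →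
                         (∀ t → c < t → A t * F t ≡ pow (t - a) (suc k) * G t) →
                         ∀ t → c < t → A t * F₁ t ≡ pow (t - a) k * G t
  cancel-linear-factor k a c {A} {G} {F} {F₁} a≤c F≡ AF≡ t c<t =
    *-cancelˡ-≢0 (t - a) _ _ (p<q⇒q-p≢0 (≤-<-trans a≤c c<t)) (begin
      (t - a) * (A t * F₁ t)       ≡⟨ solve 3 (λ d u v → d :* (u :* v) := u :* (d :* v)) refl (t - a) (A t) (F₁ t) ⟩
      A t * ((t - a) * F₁ t)       ≡⟨ cong (A t *_) (sym (F≡ t)) ⟩
      A t * F t                    ≡⟨ AF≡ t c<t ⟩
      pow (t - a) (suc k) * G t    ≡⟨ *-assoc (t - a) (pow (t - a) k) (G t) ⟩
      (t - a) * (pow (t - a) k * G t) ∎)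
    where open ≡-Reasoning

  factor-power : ∀ k {n} a c {A G F : ℚ → ℚ} → a ≤ c → Polynomial A → Polynomial G → A a ≢ 0ℚ →
                 Polynomial< (k ℕ.+ n) F → (∀ t → c < t → A t * F t ≡ pow (t - a) k * G t) →
                 ∃ λ F′ → Polynomial< n F′ × (∀ t → F t ≡ pow (t - a) k * F′ t)
  factor-power zero    a c _ _ _ _ F<n _ = _ , F<n , λ t → sym (*-identityˡ _)
  factor-power (suc k) {n} a c {A} {G} {F} a≤c A-poly G-poly Aa≢0 F<1+k+n AF≡ = F′ , F′<n , λ t → begin
    F t                               ≡⟨ F≡[t-a]F₁ t ⟩
    (t - a) * F₁ t                    ≡⟨ cong ((t - a) *_) (F₁≡[t-a]ᵏF′ t) ⟩
    (t - a) * (pow (t - a) k * F′ t)  ≡⟨ sym (*-assoc (t - a) (pow (t - a) k) (F′ t)) ⟩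
    pow (t - a) (suc k) * F′ t        ∎
    where
    open ≡-Reasoning
    Fa≡0 : F a ≡ 0ℚ
    Fa≡0 = power-factor-root k a c A-poly G-poly (polynomial<⇒polynomial F<1+k+n) Aa≢0 AF≡
    root-factored : ∃ λ F₁ → Polynomial< (k ℕ.+ n) F₁ × (∀ t → F t ≡ (t - a) * F₁ t)
    root-factored = factor-root a F<1+k+n Fa≡0
    F₁ : ℚ → ℚ
    F₁ = proj₁ root-factored
    F≡[t-a]F₁ : ∀ t → F t ≡ (t - a) * F₁ t
    F≡[t-a]F₁ = proj₂ (proj₂ root-factored)
    rest-factored : ∃ λ F′ → Polynomial< n F′ × (∀ t → F₁ t ≡ pow (t - a) k * F′ t)
    rest-factored = factor-power k a c a≤c A-poly G-poly Aa≢0 (proj₁ (proj₂ root-factored))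
                      (cancel-linear-factor k a c {A} {G} {F} {F₁} a≤c F≡[t-a]F₁ AF≡)
    F′ : ℚ → ℚ
    F′ = proj₁ rest-factored
    F′<n : Polynomial< n F′
    F′<n = proj₁ (proj₂ rest-factored)
    F₁≡[t-a]ᵏF′ : ∀ t → F₁ t ≡ pow (t - a) k * F′ t
    F₁≡[t-a]ᵏF′ = proj₂ (proj₂ rest-factored)

  coeff : List ℚ → ℕ → ℚ
  coeff []      i       = 0ℚ
  coeff (c ∷ p) zero    = c
  coeff (c ∷ p) (suc i) = coeff p i

  LowOrderTerm : List ℚ → ℕ → ℚ → Set
  LowOrderTerm p s c = (∀ i → i ℕ.< s → coeff p i ≡ 0ℚ) × coeff p s ≡ c

  coeff-+ₚ : ∀ p q i → coeff (p +ₚ q) i ≡ coeff p i + coeff q i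
  coeff-+ₚ []      q       i       = sym (+-identityˡ _)
  coeff-+ₚ (c ∷ p) []      i       = sym (+-identityʳ _)
  coeff-+ₚ (c ∷ p) (d ∷ q) zero    = refl
  coeff-+ₚ (c ∷ p) (d ∷ q) (suc i) = coeff-+ₚ p q i

  coeff-•ₚ : ∀ a p i → coeff (a •ₚ p) i ≡ a * coeff p i
  coeff-•ₚ a []      i       = sym (*-zeroʳ a)
  coeff-•ₚ a (c ∷ p) zero    = refl
  coeff-•ₚ a (c ∷ p) (suc i) = coeff-•ₚ a p i

  coeff-∷-*ₚ : ∀ c p q i → coeff ((c ∷ p) *ₚ q) i ≡ c * coeff q i + coeff (0ℚ ∷ p *ₚ q) i
  coeff-∷-*ₚ c p q i = trans (coeff-+ₚ (c •ₚ q) (0ℚ ∷ p *ₚ q) i) (cong (_+ coeff (0ℚ ∷ p *ₚ q) i) (coeff-•ₚ c q i))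

  lowOrderTerm-*ₚ : ∀ {s u c d} p q → LowOrderTerm p s c → LowOrderTerm q u d →
                    LowOrderTerm (p *ₚ q) (s ℕ.+ u) (c * d)
  lowOrderTerm-*ₚ {d = d} [] q (_ , refl) _ = (λ _ _ → refl) , sym (*-zeroˡ d)
  lowOrderTerm-*ₚ {zero} {u} (c ∷ p) q (_ , refl) (q-low , refl) = low , lowest
    where
    pq-low : ∀ i → i ℕ.< u → coeff (p *ₚ q) i ≡ 0ℚ
    pq-low = proj₁ (lowOrderTerm-*ₚ p q ((λ _ ()) , refl) (q-low , refl))
    shifted-low : ∀ i → i ℕ.≤ u → coeff (0ℚ ∷ p *ₚ q) i ≡ 0ℚ
    shifted-low zero    _   = refl
    shifted-low (suc i) i<u = pq-low i i<u
    low : ∀ i → i ℕ.< u → coeff ((c ∷ p) *ₚ q) i ≡ 0ℚ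
    low i i<u = begin
      coeff ((c ∷ p) *ₚ q) i                   ≡⟨ coeff-∷-*ₚ c p q i ⟩
      c * coeff q i + coeff (0ℚ ∷ p *ₚ q) i    ≡⟨ cong₂ (λ u v → c * u + v) (q-low i i<u) (shifted-low i (ℕ.<⇒≤ i<u)) ⟩
      c * 0ℚ + 0ℚ                              ≡⟨ solve 1 (λ c → c :* con 0ℚ :+ con 0ℚ := con 0ℚ) refl c ⟩
      0ℚ                                       ∎
      where open ≡-Reasoning
    lowest : coeff ((c ∷ p) *ₚ q) u ≡ c * coeff q u
    lowest = trans (coeff-∷-*ₚ c p q u) (trans (cong (c * coeff q u +_) (shifted-low u ℕ.≤-refl)) (+-identityʳ _))
  lowOrderTerm-*ₚ {suc s} {u} {c} {d} (a ∷ p) q (p-low , p-lowest) q-term = low , lowest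
    where
    dropped : ∀ i → coeff ((a ∷ p) *ₚ q) i ≡ coeff (0ℚ ∷ p *ₚ q) i
    dropped i = begin
      coeff ((a ∷ p) *ₚ q) i                ≡⟨ coeff-∷-*ₚ a p q i ⟩
      a * coeff q i + coeff (0ℚ ∷ p *ₚ q) i
        ≡⟨ cong (λ v → v * coeff q i + coeff (0ℚ ∷ p *ₚ q) i) (p-low 0 (s≤s z≤n)) ⟩
      0ℚ * coeff q i + coeff (0ℚ ∷ p *ₚ q) i
        ≡⟨ solve 2 (λ v w → con 0ℚ :* v :+ w := w) refl (coeff q i) (coeff (0ℚ ∷ p *ₚ q) i) ⟩
      coeff (0ℚ ∷ p *ₚ q) i ∎
      where open ≡-Reasoning
    pq-term : LowOrderTerm (p *ₚ q) (s ℕ.+ u) (c * d)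
    pq-term = lowOrderTerm-*ₚ p q ((λ i i<s → p-low (suc i) (s≤s i<s)) , p-lowest) q-term
    low : ∀ i → i ℕ.< suc s ℕ.+ u → coeff ((a ∷ p) *ₚ q) i ≡ 0ℚ
    low zero    _         = dropped zero
    low (suc i) (s≤s i<s) = trans (dropped (suc i)) (proj₁ pq-term i i<s)
    lowest : coeff ((a ∷ p) *ₚ q) (suc s ℕ.+ u) ≡ c * d
    lowest = trans (dropped (suc (s ℕ.+ u))) (proj₂ pq-term)

  lowOrderTerm-^ₚ : ∀ {s c} p k → LowOrderTerm p s c → LowOrderTerm (p ^ₚ k) (k ℕ.* s) (pow c k)
  lowOrderTerm-^ₚ p zero    _      = (λ _ ()) , refl
  lowOrderTerm-^ₚ p (suc k) p-term = lowOrderTerm-*ₚ p (p ^ₚ k) p-term (lowOrderTerm-^ₚ p k p-term)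

  pad : ∀ n → List ℚ → Vec ℚ n
  pad zero    p       = []
  pad (suc n) []      = 0ℚ ∷ pad n []
  pad (suc n) (c ∷ p) = c ∷ pad n p

  eval-pad : ∀ n p t → length p ℕ.≤ n → eval (toList (pad n p)) t ≡ eval p t
  eval-pad zero    []      t _         = refl
  eval-pad (suc n) []      t _         = trans (cong (λ u → 0ℚ + t * u) (eval-pad n [] t z≤n))
                                               (solve 1 (λ t → con 0ℚ :+ t :* con 0ℚ := con 0ℚ) refl t)
  eval-pad (suc n) (c ∷ p) t (s≤s p≤n) = cong (λ u → c + t * u) (eval-pad n p t p≤n)

  lookup-pad : ∀ n p (i : Fin n) → lookup (pad n p) i ≡ coeff p (toℕ i)
  lookup-pad (suc n) []      fzero    = refl
  lookup-pad (suc n) []      (fsuc i) = lookup-pad n [] i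
  lookup-pad (suc n) (c ∷ p) fzero    = refl
  lookup-pad (suc n) (c ∷ p) (fsuc i) = lookup-pad n p i

module LinearAlgebra where

  open import Data.Fin using (Fin; toℕ; fromℕ<) renaming (zero to fzero; suc to fsuc)
  import Data.Fin.Properties as Fin
  open import Data.Nat as ℕ using (ℕ; zero; suc; z≤n; s≤s)
  import Data.Nat.Properties as ℕ
  open import Data.Product using (∃; _,_; proj₁; proj₂)
  open import Data.Rational using (ℚ; 0ℚ; 1ℚ; _+_; _*_; -_)
  open import Data.Rational.Solver using (module +-*-Solver)
  open import Data.Sum using (inj₁; inj₂)
  open import Data.Vec using (Vec; []; _∷_; lookup)
  import Data.Vec.Properties as Vec
  open import Relation.Binary.PropositionalEquality
  open +-*-Solver using (solve; _:=_; _:+_; _:*_; :-_; con)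

  VanishesBelow : ∀ {n} → ℕ → Vec ℚ n → Set
  VanishesBelow s w = ∀ i → toℕ i ℕ.< s → lookup w i ≡ 0ℚ

  lookup-ext : ∀ {n} (u w : Vec ℚ n) → (∀ i → lookup u i ≡ lookup w i) → u ≡ w
  lookup-ext u w u≗w = trans (sym (Vec.tabulate∘lookup u)) (trans (Vec.tabulate-cong u≗w) (Vec.tabulate∘lookup w))

  lookup-zeroV : ∀ {n} (i : Fin n) → lookup (zeroV n) i ≡ 0ℚ
  lookup-zeroV i = Vec.lookup-replicate i 0ℚ

  lookup-⊙⊕ : ∀ {n} a (u w : Vec ℚ n) i → lookup ((a ⊙ u) ⊕ w) i ≡ a * lookup u i + lookup w i
  lookup-⊙⊕ a u w i = trans (Vec.lookup-zipWith _+_ i (a ⊙ u) w) (cong (_+ lookup w i) (Vec.lookup-map i (a *_) u))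

  module Echelon {n : ℕ} (S : Vec ℚ n → Set) (S-closed : ∀ a u w → S u → S w → S ((a ⊙ u) ⊕ w))
                 (M : ℕ) (M≤n : M ℕ.≤ n) (f : ℕ → Vec ℚ n)
                 (f∈S : ∀ j → j ℕ.< M → S (f j))
                 (f-low : ∀ j → j ℕ.< M → VanishesBelow j (f j))
                 (f-pivot : ∀ j → j ℕ.< M → ∀ i → toℕ i ≡ j → lookup (f j) i ≡ 1ℚ)
                 (S-low⇒0 : ∀ w → S w → VanishesBelow M w → w ≡ zeroV n) where

    family : ℕ → (k : ℕ) → Vec (Vec ℚ n) k
    family s zero    = []
    family s (suc k) = f s ∷ family (suc s) k

    lookup-family : ∀ s k (j : Fin k) → lookup (family s k) j ≡ f (s ℕ.+ toℕ j)
    lookup-family s (suc k) fzero    = cong f (sym (ℕ.+-identityʳ s))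
    lookup-family s (suc k) (fsuc j) = trans (lookup-family (suc s) k j) (cong f (sym (ℕ.+-suc s (toℕ j))))

    pivot : ∀ s → s ℕ.< M → Fin n
    pivot s s<M = fromℕ< (ℕ.<-≤-trans s<M M≤n)

    toℕ-pivot : ∀ s (s<M : s ℕ.< M) → toℕ (pivot s s<M) ≡ s
    toℕ-pivot s s<M = Fin.toℕ-fromℕ< (ℕ.<-≤-trans s<M M≤n)

    linComb-low : ∀ s k a → s ℕ.+ k ℕ.≤ M → VanishesBelow s (linComb a (family s k))
    linComb-low s zero    []       _     i _   = lookup-zeroV i
    linComb-low s (suc k) (a ∷ as) s+k<M i i<s = begin
      lookup ((a ⊙ f s) ⊕ linComb as (family (suc s) k)) i
        ≡⟨ lookup-⊙⊕ a (f s) _ i ⟩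
      a * lookup (f s) i + lookup (linComb as (family (suc s) k)) i
        ≡⟨ cong₂ (λ u v → a * u + v) (f-low s s<M i i<s)
             (linComb-low (suc s) k as (subst (ℕ._≤ M) (ℕ.+-suc s k) s+k<M) i (ℕ.m<n⇒m<1+n i<s)) ⟩
      a * 0ℚ + 0ℚ
        ≡⟨ solve 1 (λ a → a :* con 0ℚ :+ con 0ℚ := con 0ℚ) refl a ⟩
      0ℚ ∎
      where
      open ≡-Reasoning
      s<M : s ℕ.< M
      s<M = ℕ.<-≤-trans (ℕ.m<m+n s (s≤s z≤n)) s+k<M

    family-independent : ∀ s k → s ℕ.+ k ℕ.≤ M → LinIndep (family s k)
    family-independent s zero    _     []       _        = refl
    family-independent s (suc k) s+k<M (a ∷ as) comb≡0 =
      cong₂ _∷_ a≡0 (family-independent (suc s) k s+1+k≤M as rest≡0)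
      where
      open ≡-Reasoning
      s<M : s ℕ.< M
      s<M = ℕ.<-≤-trans (ℕ.m<m+n s (s≤s z≤n)) s+k<M
      s+1+k≤M : suc s ℕ.+ k ℕ.≤ M
      s+1+k≤M = subst (ℕ._≤ M) (ℕ.+-suc s k) s+k<M
      rest = linComb as (family (suc s) k)
      comb-at : ∀ i → a * lookup (f s) i + lookup rest i ≡ 0ℚ
      comb-at i = trans (sym (lookup-⊙⊕ a (f s) rest i)) (trans (cong (λ v → lookup v i) comb≡0) (lookup-zeroV i))
      p : Fin n
      p = pivot s s<M
      a≡0 : a ≡ 0ℚ
      a≡0 = begin
        a                                ≡⟨ solve 1 (λ a → a := a :* con 1ℚ :+ con 0ℚ) refl a ⟩
        a * 1ℚ + 0ℚ                      ≡⟨ cong₂ (λ u v → a * u + v) (sym (f-pivot s s<M p (toℕ-pivot s s<M)))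
                                              (sym (linComb-low (suc s) k as s+1+k≤M p (s≤s (ℕ.≤-reflexive (toℕ-pivot s s<M))))) ⟩
        a * lookup (f s) p + lookup rest p ≡⟨ comb-at p ⟩
        0ℚ                               ∎
      rest≡0 : rest ≡ zeroV n
      rest≡0 = lookup-ext rest (zeroV n) λ i → begin
        lookup rest i                       ≡⟨ solve 2 (λ u r → r := con 0ℚ :* u :+ r) refl (lookup (f s) i) (lookup rest i) ⟩
        0ℚ * lookup (f s) i + lookup rest i ≡⟨ cong (λ u → u * lookup (f s) i + lookup rest i) (sym a≡0) ⟩
        a * lookup (f s) i + lookup rest i  ≡⟨ comb-at i ⟩
        0ℚ                                  ≡⟨ sym (lookup-zeroV i) ⟩
        lookup (zeroV n) i                  ∎

    -- Gaussian elimination: subtracting the right multiple of f s clears coordinate s.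
    family-spans : ∀ s k → s ℕ.+ k ≡ M → ∀ w → S w → VanishesBelow s w →
                   ∃ λ a → linComb a (family s k) ≡ w
    family-spans s zero s≡M w w∈S w-low =
      [] , sym (S-low⇒0 w w∈S (subst (λ m → VanishesBelow m w) (trans (sym (ℕ.+-identityʳ s)) s≡M) w-low))
    family-spans s (suc k) s+k≡M w w∈S w-low = a ∷ as , lookup-ext _ w λ i → begin
      lookup ((a ⊙ f s) ⊕ linComb as (family (suc s) k)) i ≡⟨ lookup-⊙⊕ a (f s) _ i ⟩
      a * lookup (f s) i + lookup (linComb as (family (suc s) k)) i
        ≡⟨ cong (λ v → a * lookup (f s) i + lookup v i) comb≡w′ ⟩
      a * lookup (f s) i + lookup w′ i          ≡⟨ cong (a * lookup (f s) i +_) (lookup-⊙⊕ (- a) (f s) w i) ⟩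
      a * lookup (f s) i + (- a * lookup (f s) i + lookup w i)
        ≡⟨ solve 3 (λ a u v → a :* u :+ ((:- a) :* u :+ v) := v) refl a (lookup (f s) i) (lookup w i) ⟩
      lookup w i                                ∎
      where
      open ≡-Reasoning
      s<M : s ℕ.< M
      s<M = subst (s ℕ.<_) s+k≡M (ℕ.m<m+n s (s≤s z≤n))
      a = lookup w (pivot s s<M)
      w′ = ((- a) ⊙ f s) ⊕ w
      w′-low : VanishesBelow (suc s) w′
      w′-low i i<1+s with ℕ.m<1+n⇒m<n∨m≡n i<1+s
      ... | inj₁ i<s = trans (lookup-⊙⊕ (- a) (f s) w i)
        (trans (cong₂ (λ u v → - a * u + v) (f-low s s<M i i<s) (w-low i i<s))
               (solve 1 (λ a → (:- a) :* con 0ℚ :+ con 0ℚ := con 0ℚ) refl a))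
      ... | inj₂ i≡s = trans (lookup-⊙⊕ (- a) (f s) w i)
        (trans (cong₂ (λ u v → - a * u + v) (f-pivot s s<M i i≡s)
                      (cong (lookup w) (Fin.toℕ-injective (trans i≡s (sym (toℕ-pivot s s<M))))))
               (solve 1 (λ a → (:- a) :* con 1ℚ :+ a := con 0ℚ) refl a))
      spanned : ∃ λ as → linComb as (family (suc s) k) ≡ w′
      spanned = family-spans (suc s) k (trans (sym (ℕ.+-suc s k)) s+k≡M) w′
                  (S-closed (- a) (f s) w (f∈S s s<M) w∈S) w′-low
      as : Vec ℚ k
      as = proj₁ spanned
      comb≡w′ : linComb as (family (suc s) k) ≡ w′
      comb≡w′ = proj₂ spanned

    hasDim : HasDim S M
    hasDim = family 0 M ,
      (λ j → subst S (sym (lookup-family 0 M j)) (f∈S (toℕ j) (Fin.toℕ<n j))) ,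
      family-independent 0 M ℕ.≤-refl ,
      (λ w w∈S → family-spans 0 M refl w w∈S (λ _ ()))

module FayShuffle where

  open import Data.Fin using (Fin; toℕ) renaming (zero to fzero; suc to fsuc)
  import Data.Fin.Properties as Fin
  open import Data.List using (List; []; _∷_; length; replicate; _++_)
  open import Data.Nat as ℕ using (ℕ; zero; suc; _∸_; z≤n; s≤s; ⌊_/2⌋; parity)
  open import Data.Nat.DivMod using (_/_; _%_; m≡m%n+[m/n]*n; m%n<n; m/n*n≤m; m/n≤m)
  import Data.Nat.Properties as ℕ
  open import Data.Nat.Tactic.RingSolver using (solve-∀)
  open import Data.Parity using (Parity; 0ℙ; 1ℙ)
  open import Data.Product using (∃; _×_; _,_; proj₁; proj₂)
  open import Data.Rational using (ℚ; 0ℚ; 1ℚ; _+_; _*_; -_; _-_; _<_)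
  open import Data.Rational.Properties
  open import Data.Rational.Solver using (module +-*-Solver)
  open import Data.Vec using (Vec; []; _∷_; tabulate; lookup; toList)
  import Data.Vec.Properties as Vec
  open import Function using (_∘_)
  open import Relation.Binary.PropositionalEquality
  open +-*-Solver using (solve; _:=_; _:+_; _:*_; _:-_; :-_; con)
  open RationalArithmetic
  open Polynomials
  open LinearAlgebra

  Σℚ-scale : ∀ {n} a (f : Fin n → ℚ) → Σℚ (tabulate (λ i → a * f i)) ≡ a * Σℚ (tabulate f)
  Σℚ-scale {zero}  a f = sym (*-zeroʳ a)
  Σℚ-scale {suc n} a f = trans (cong (a * f fzero +_) (Σℚ-scale a (λ i → f (fsuc i))))
    (sym (*-distribˡ-+ a (f fzero) _))

  Σℚ-+ : ∀ {n} (f g : Fin n → ℚ) → Σℚ (tabulate (λ i → f i + g i)) ≡ Σℚ (tabulate f) + Σℚ (tabulate g)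
  Σℚ-+ {zero}  f g = refl
  Σℚ-+ {suc n} f g = trans (cong (f fzero + g fzero +_) (Σℚ-+ (λ i → f (fsuc i)) (λ i → g (fsuc i))))
    (solve 4 (λ a b c d → (a :+ b) :+ (c :+ d) := (a :+ c) :+ (b :+ d)) refl (f fzero) (g fzero) _ _)

  record Homogeneous (d : ℕ) (g : ℚ → ℚ → ℚ) : Set where
    constructor homogeneous
    field homogeneity : ∀ l x y → g (l * x) (l * y) ≡ pow l d * g x y

  open Homogeneous

  homogeneous-* : ∀ {d e g h} → Homogeneous d g → Homogeneous e h →
                  Homogeneous (d ℕ.+ e) (λ x y → g x y * h x y)
  homogeneous-* {d} {e} {g} {h} g-hom h-hom = homogeneous λ l x y → begin
    g (l * x) (l * y) * h (l * x) (l * y)       ≡⟨ cong₂ _*_ (homogeneity g-hom l x y) (homogeneity h-hom l x y) ⟩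
    (pow l d * g x y) * (pow l e * h x y)
      ≡⟨ solve 4 (λ a u b v → (a :* u) :* (b :* v) := (a :* b) :* (u :* v)) refl (pow l d) (g x y) (pow l e) (h x y) ⟩
    (pow l d * pow l e) * (g x y * h x y)       ≡⟨ cong (_* (g x y * h x y)) (sym (pow-distribˡ-+-* l d e)) ⟩
    pow l (d ℕ.+ e) * (g x y * h x y)           ∎
    where open ≡-Reasoning

  homogeneous-pow : ∀ {d g} k → Homogeneous d g → Homogeneous (k ℕ.* d) (λ x y → pow (g x y) k)
  homogeneous-pow {d} {g} k g-hom = homogeneous λ l x y → begin
    pow (g (l * x) (l * y)) k         ≡⟨ cong (λ u → pow u k) (homogeneity g-hom l x y) ⟩
    pow (pow l d * g x y) k           ≡⟨ pow-distribʳ-* (pow l d) (g x y) k ⟩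
    pow (pow l d) k * pow (g x y) k   ≡⟨ cong (_* pow (g x y) k) (pow-*-assoc l d k) ⟩
    pow l (d ℕ.* k) * pow (g x y) k   ≡⟨ cong (λ e → pow l e * pow (g x y) k) (ℕ.*-comm d k) ⟩
    pow l (k ℕ.* d) * pow (g x y) k   ∎
    where open ≡-Reasoning

  homogeneous-agree : ∀ {d g h} → Homogeneous d g → Homogeneous d h → (∀ t → g t 1ℚ ≡ h t 1ℚ) →
                      ∀ x y → y ≢ 0ℚ → g x y ≡ h x y
  homogeneous-agree {d} {g} {h} g-hom h-hom g≡h x y y≢0 = begin
    g x y                      ≡⟨ cong₂ g (sym y*s≡x) (sym (*-identityʳ y)) ⟩
    g (y * s) (y * 1ℚ)         ≡⟨ homogeneity g-hom y s 1ℚ ⟩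
    pow y d * g s 1ℚ           ≡⟨ cong (pow y d *_) (g≡h s) ⟩
    pow y d * h s 1ℚ           ≡⟨ sym (homogeneity h-hom y s 1ℚ) ⟩
    h (y * s) (y * 1ℚ)         ≡⟨ cong₂ h y*s≡x (*-identityʳ y) ⟩
    h x y                      ∎
    where
    open ≡-Reasoning
    s = x * inv y
    y*s≡x : y * s ≡ x
    y*s≡x = trans (solve 3 (λ y x i → y :* (x :* i) := x :* (i :* y)) refl y x (inv y))
                  (trans (cong (x *_) (inv-inverseˡ y y≢0)) (*-identityʳ x))

  numer-homogeneous : ∀ N v → Homogeneous N (numer N v)
  numer-homogeneous N v = homogeneous scale
    where
    scale : ∀ l x y → numer N v (l * x) (l * y) ≡ pow l N * numer N v x y
    scale l x y = trans (cong Σℚ (Vec.tabulate-cong term)) (Σℚ-scale (pow l N) m)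
      where
      m : Fin (suc N) → ℚ
      m i = lookup v i * (pow x (toℕ i) * pow y (N ∸ toℕ i))
      term : ∀ i → lookup v i * (pow (l * x) (toℕ i) * pow (l * y) (N ∸ toℕ i)) ≡ pow l N * m i
      term i = begin
        lookup v i * (pow (l * x) (toℕ i) * pow (l * y) (N ∸ toℕ i))
          ≡⟨ cong₂ (λ u w → lookup v i * (u * w)) (pow-distribʳ-* l x (toℕ i)) (pow-distribʳ-* l y (N ∸ toℕ i)) ⟩
        lookup v i * ((pow l (toℕ i) * pow x (toℕ i)) * (pow l (N ∸ toℕ i) * pow y (N ∸ toℕ i)))
          ≡⟨ solve 5 (λ c a b p q → c :* ((a :* b) :* (p :* q)) := (a :* p) :* (c :* (b :* q))) refl
               (lookup v i) (pow l (toℕ i)) (pow x (toℕ i)) (pow l (N ∸ toℕ i)) (pow y (N ∸ toℕ i)) ⟩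
        (pow l (toℕ i) * pow l (N ∸ toℕ i)) * m i
          ≡⟨ cong (_* m i) (trans (sym (pow-distribˡ-+-* l (toℕ i) (N ∸ toℕ i)))
                                  (cong (pow l) (ℕ.m+[n∸m]≡n (Fin.toℕ≤pred[n] i)))) ⟩
        pow l N * m i ∎
        where open ≡-Reasoning

  numer-⊙⊕ : ∀ N a u w x y → numer N ((a ⊙ u) ⊕ w) x y ≡ a * numer N u x y + numer N w x y
  numer-⊙⊕ N a u w x y = trans (cong Σℚ (Vec.tabulate-cong term))
    (trans (Σℚ-+ (λ i → a * (lookup u i * m i)) (λ i → lookup w i * m i))
           (cong (_+ numer N w x y) (Σℚ-scale a (λ i → lookup u i * m i))))
    where
    m : Fin (suc N) → ℚ
    m i = pow x (toℕ i) * pow y (N ∸ toℕ i)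
    term : ∀ i → lookup ((a ⊙ u) ⊕ w) i * m i ≡ a * (lookup u i * m i) + lookup w i * m i
    term i = trans (cong (_* m i) (lookup-⊙⊕ a u w i))
      (solve 4 (λ a b c d → (a :* b :+ c) :* d := a :* (b :* d) :+ c :* d) refl a (lookup u i) (lookup w i) (m i))

  evalHom : List ℚ → ℕ → ℚ → ℚ → ℚ
  evalHom []      d x y = 0ℚ
  evalHom (c ∷ l) d x y = c * pow y d + x * evalHom l (d ∸ 1) x y

  Σℚ≡evalHom : ∀ {n} (v : Vec ℚ n) d x y →
               Σℚ (tabulate (λ i → lookup v i * (pow x (toℕ i) * pow y (d ∸ toℕ i)))) ≡ evalHom (toList v) d x y
  Σℚ≡evalHom []      d x y = refl
  Σℚ≡evalHom (c ∷ v) d x y = cong₂ _+_ (cong (c *_) (*-identityˡ (pow y d))) (begin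
    Σℚ (tabulate (λ i → lookup v i * (x * pow x (toℕ i) * pow y (d ∸ suc (toℕ i)))))
      ≡⟨ cong Σℚ (Vec.tabulate-cong term) ⟩
    Σℚ (tabulate (λ i → x * (lookup v i * (pow x (toℕ i) * pow y (d ∸ 1 ∸ toℕ i)))))
      ≡⟨ Σℚ-scale x (λ i → lookup v i * (pow x (toℕ i) * pow y (d ∸ 1 ∸ toℕ i))) ⟩
    x * Σℚ (tabulate (λ i → lookup v i * (pow x (toℕ i) * pow y (d ∸ 1 ∸ toℕ i))))
      ≡⟨ cong (x *_) (Σℚ≡evalHom v (d ∸ 1) x y) ⟩
    x * evalHom (toList v) (d ∸ 1) x y ∎)
    where
    open ≡-Reasoning
    term : ∀ i → lookup v i * (x * pow x (toℕ i) * pow y (d ∸ suc (toℕ i))) ≡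
                 x * (lookup v i * (pow x (toℕ i) * pow y (d ∸ 1 ∸ toℕ i)))
    term i = trans (cong (λ e → lookup v i * (x * pow x (toℕ i) * pow y e)) (sym (ℕ.∸-+-assoc d 1 (toℕ i))))
      (solve 4 (λ c x p q → c :* ((x :* p) :* q) := x :* (c :* (p :* q))) refl
         (lookup v i) x (pow x (toℕ i)) (pow y (d ∸ 1 ∸ toℕ i)))

  numer≡evalHom : ∀ N v x y → numer N v x y ≡ evalHom (toList v) N x y
  numer≡evalHom N v = Σℚ≡evalHom v N

  evalHom-dehomogenise : ∀ l d t → evalHom l d t 1ℚ ≡ eval l t
  evalHom-dehomogenise []      d t = refl
  evalHom-dehomogenise (c ∷ l) d t = trans
    (cong₂ (λ u v → c * u + t * v) (pow-1ℚ d) (evalHom-dehomogenise l (d ∸ 1) t))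
    (cong (_+ t * eval l t) (*-identityʳ c))

  numer-dehomogenise : ∀ N v t → numer N v t 1ℚ ≡ eval (toList v) t
  numer-dehomogenise N v t = trans (numer≡evalHom N v t 1ℚ) (evalHom-dehomogenise (toList v) N t)

  evalHom-replicate : ∀ j l d x y → evalHom (replicate j 0ℚ ++ l) d x y ≡ pow x j * evalHom l (d ∸ j) x y
  evalHom-replicate zero    l d x y = sym (*-identityˡ (evalHom l d x y))
  evalHom-replicate (suc j) l d x y = begin
    0ℚ * pow y d + x * evalHom (replicate j 0ℚ ++ l) (d ∸ 1) x y
      ≡⟨ cong (λ u → 0ℚ * pow y d + x * u) (evalHom-replicate j l (d ∸ 1) x y) ⟩
    0ℚ * pow y d + x * (pow x j * evalHom l (d ∸ 1 ∸ j) x y)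
      ≡⟨ cong (λ e → 0ℚ * pow y d + x * (pow x j * evalHom l e x y)) (ℕ.∸-+-assoc d 1 j) ⟩
    0ℚ * pow y d + x * (pow x j * evalHom l (d ∸ suc j) x y)
      ≡⟨ solve 4 (λ a x p h → con 0ℚ :* a :+ x :* (p :* h) := (x :* p) :* h) refl
           (pow y d) x (pow x j) (evalHom l (d ∸ suc j) x y) ⟩
    x * pow x j * evalHom l (d ∸ suc j) x y ∎
    where open ≡-Reasoning

  -- truncated subtraction makes this hold for lists of any length
  evalHom-polynomial< : ∀ l d → Polynomial< (suc d) (λ t → evalHom l d 1ℚ t)
  evalHom-polynomial< []      d = [] , z≤n , λ _ → refl
  evalHom-polynomial< (c ∷ l) d = polynomial<-cong (λ t → cong (c * pow t d +_) (sym (*-identityˡ _)))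
    (polynomial<-+ (polynomial<-monomial c d)
                   (polynomial<-mono (s≤s (ℕ.m∸n≤m d 1)) (evalHom-polynomial< l (d ∸ 1))))

  evalHom-polynomial : ∀ l d {P Q} → Polynomial P → Polynomial Q → Polynomial (λ t → evalHom l d (P t) (Q t))
  evalHom-polynomial []      d P-poly Q-poly = polynomial-const 0ℚ
  evalHom-polynomial (c ∷ l) d P-poly Q-poly = polynomial-+
    (polynomial-* (polynomial-const c) (polynomial-pow d Q-poly))
    (polynomial-* P-poly (evalHom-polynomial l (d ∸ 1) P-poly Q-poly))

  -- The first Fay-shuffle relation for P = g/(XY), multiplied by XY(X+Y).
  FayRelation : (ℚ → ℚ → ℚ) → Set
  FayRelation g = ∀ x y → x ≢ 0ℚ → y ≢ 0ℚ → x + y ≢ 0ℚ →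
    (x + y) * g x y ≡ x * g (x + y) (- y) + y * g (- x + - y) x

  Antisymmetric : (ℚ → ℚ → ℚ) → Set
  Antisymmetric g = ∀ x y → x ≢ 0ℚ → y ≢ 0ℚ → g x y + g y x ≡ 0ℚ

  fay-cleared : ∀ (g : ℚ → ℚ → ℚ) x y → x ≢ 0ℚ → y ≢ 0ℚ → x + y ≢ 0ℚ →
    x * y * (x + y) * (g x y * inv (x * y) + g (x + y) (- y) * inv ((x + y) * - y) + g (- x + - y) x * inv ((- x + - y) * x))
    ≡ (x + y) * g x y - (x * g (x + y) (- y) + y * g (- x + - y) x)
  fay-cleared g x y x≢0 y≢0 x+y≢0 = begin
    D * (a * inv d₁ + b * inv d₂ + c * inv d₃)
      ≡⟨ solve 7 (λ D a b c i₁ i₂ i₃ → D :* (a :* i₁ :+ b :* i₂ :+ c :* i₃)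
                                      := a :* (D :* i₁) :+ b :* (D :* i₂) :+ c :* (D :* i₃))
           refl D a b c (inv d₁) (inv d₂) (inv d₃) ⟩
    a * (D * inv d₁) + b * (D * inv d₂) + c * (D * inv d₃)
      ≡⟨ cong₂ _+_
           (cong₂ (λ u v → a * u + b * v)
             (D/d≡ d₁ (x + y) d₁≢0 refl)
             (D/d≡ d₂ (- x) d₂≢0 (solve 2 (λ x y → x :* y :* (x :+ y) := (x :+ y) :* (:- y) :* (:- x)) refl x y)))
           (cong (c *_) (D/d≡ d₃ (- y) d₃≢0 (solve 2 (λ x y → x :* y :* (x :+ y) := (:- x :+ :- y) :* x :* (:- y)) refl x y))) ⟩
    a * (x + y) + b * - x + c * - y
      ≡⟨ solve 5 (λ x y a b c → a :* (x :+ y) :+ b :* (:- x) :+ c :* (:- y) := (x :+ y) :* a :- (x :* b :+ y :* c))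
           refl x y a b c ⟩
    (x + y) * a - (x * b + y * c) ∎
    where
    open ≡-Reasoning
    D = x * y * (x + y)
    a = g x y
    b = g (x + y) (- y)
    c = g (- x + - y) x
    d₁ = x * y
    d₂ = (x + y) * - y
    d₃ = (- x + - y) * x
    d₁≢0 : d₁ ≢ 0ℚ
    d₁≢0 = p*q≢0 x y x≢0 y≢0
    d₂≢0 : d₂ ≢ 0ℚ
    d₂≢0 = p*q≢0 (x + y) (- y) x+y≢0 (-p≢0 y y≢0)
    d₃≢0 : d₃ ≢ 0ℚ
    d₃≢0 = p*q≢0 (- x + - y) x (-x-y≢0 x y x+y≢0) x≢0
    D/d≡ : ∀ d e → d ≢ 0ℚ → D ≡ d * e → D * inv d ≡ e
    D/d≡ d e d≢0 D≡de = trans (cong (_* inv d) D≡de) (*-inv-cancelˡ d e d≢0)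

  antisymmetry-cleared : ∀ (g : ℚ → ℚ → ℚ) x y →
                         g x y * inv (x * y) + g y x * inv (y * x) ≡ (g x y + g y x) * inv (x * y)
  antisymmetry-cleared g x y = trans (cong (λ d → g x y * inv (x * y) + g y x * inv d) (*-comm y x))
    (sym (*-distribʳ-+ (inv (x * y)) (g x y) (g y x)))

  IsFSh₂⇒fay : ∀ N v → IsFSh₂ N v → FayRelation (numer N v)
  IsFSh₂⇒fay N v (fay , _) x y x≢0 y≢0 x+y≢0 = p-q≡0⇒p≡q _ _ (begin
    (x + y) * numer N v x y - (x * numer N v (x + y) (- y) + y * numer N v (- x + - y) x)
      ≡⟨ sym (fay-cleared (numer N v) x y x≢0 y≢0 x+y≢0) ⟩
    x * y * (x + y) * (evalP N v x y + evalP N v (x + y) (- y) + evalP N v (- x + - y) x)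
      ≡⟨ cong (x * y * (x + y) *_) (fay x y x≢0 y≢0 x+y≢0) ⟩
    x * y * (x + y) * 0ℚ
      ≡⟨ *-zeroʳ (x * y * (x + y)) ⟩
    0ℚ ∎)
    where open ≡-Reasoning

  IsFSh₂⇒antisymmetric : ∀ N v → IsFSh₂ N v → Antisymmetric (numer N v)
  IsFSh₂⇒antisymmetric N v (_ , antisym) x y x≢0 y≢0 =
    p*q≡0⇒p≡0 (numer N v x y + numer N v y x) (inv (x * y)) (inv≢0 (x * y) (p*q≢0 x y x≢0 y≢0))
      (trans (sym (antisymmetry-cleared (numer N v) x y)) (antisym x y x≢0 y≢0))

  fay∧antisymmetric⇒IsFSh₂ : ∀ N v → FayRelation (numer N v) → Antisymmetric (numer N v) → IsFSh₂ N v
  fay∧antisymmetric⇒IsFSh₂ N v fay antisym = fay′ , antisym′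
    where
    fay′ : ∀ x y → x ≢ 0ℚ → y ≢ 0ℚ → x + y ≢ 0ℚ →
           evalP N v x y + evalP N v (x + y) (- y) + evalP N v (- x + - y) x ≡ 0ℚ
    fay′ x y x≢0 y≢0 x+y≢0 = p*q≡0⇒q≡0 (x * y * (x + y)) _ (p*q≢0 (x * y) (x + y) (p*q≢0 x y x≢0 y≢0) x+y≢0)
      (trans (fay-cleared (numer N v) x y x≢0 y≢0 x+y≢0)
             (trans (cong (_- rhs) (fay x y x≢0 y≢0 x+y≢0)) (+-inverseʳ rhs)))
      where rhs = x * numer N v (x + y) (- y) + y * numer N v (- x + - y) x
    antisym′ : ∀ x y → x ≢ 0ℚ → y ≢ 0ℚ → evalP N v x y + evalP N v y x ≡ 0ℚ
    antisym′ x y x≢0 y≢0 = trans (antisymmetry-cleared (numer N v) x y)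
      (trans (cong (_* inv (x * y)) (antisym x y x≢0 y≢0)) (*-zeroˡ (inv (x * y))))

  evalP-⊙⊕ : ∀ N a u w x y → evalP N ((a ⊙ u) ⊕ w) x y ≡ a * evalP N u x y + evalP N w x y
  evalP-⊙⊕ N a u w x y = trans (cong (_* inv (x * y)) (numer-⊙⊕ N a u w x y))
    (solve 4 (λ a p q i → (a :* p :+ q) :* i := a :* (p :* i) :+ q :* i) refl
       a (numer N u x y) (numer N w x y) (inv (x * y)))

  IsFSh₂-closed : ∀ N a u w → IsFSh₂ N u → IsFSh₂ N w → IsFSh₂ N ((a ⊙ u) ⊕ w)
  IsFSh₂-closed N a u w (fay-u , antisym-u) (fay-w , antisym-w) = fay , antisym
    where
    open ≡-Reasoning
    P = evalP N u
    Q = evalP N w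
    R = evalP N ((a ⊙ u) ⊕ w)
    fay : ∀ x y → x ≢ 0ℚ → y ≢ 0ℚ → x + y ≢ 0ℚ → R x y + R (x + y) (- y) + R (- x + - y) x ≡ 0ℚ
    fay x y x≢0 y≢0 x+y≢0 = begin
      R x y + R (x + y) (- y) + R (- x + - y) x
        ≡⟨ cong₂ _+_ (cong₂ _+_ (evalP-⊙⊕ N a u w x y) (evalP-⊙⊕ N a u w (x + y) (- y)))
                     (evalP-⊙⊕ N a u w (- x + - y) x) ⟩
      (a * P x y + Q x y) + (a * P (x + y) (- y) + Q (x + y) (- y)) + (a * P (- x + - y) x + Q (- x + - y) x)
        ≡⟨ solve 7 (λ a p₁ p₂ p₃ q₁ q₂ q₃ → (a :* p₁ :+ q₁) :+ (a :* p₂ :+ q₂) :+ (a :* p₃ :+ q₃)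
                                             := a :* (p₁ :+ p₂ :+ p₃) :+ (q₁ :+ q₂ :+ q₃))
             refl a (P x y) (P (x + y) (- y)) (P (- x + - y) x) (Q x y) (Q (x + y) (- y)) (Q (- x + - y) x) ⟩
      a * (P x y + P (x + y) (- y) + P (- x + - y) x) + (Q x y + Q (x + y) (- y) + Q (- x + - y) x)
        ≡⟨ cong₂ (λ p q → a * p + q) (fay-u x y x≢0 y≢0 x+y≢0) (fay-w x y x≢0 y≢0 x+y≢0) ⟩
      a * 0ℚ + 0ℚ
        ≡⟨ solve 1 (λ a → a :* con 0ℚ :+ con 0ℚ := con 0ℚ) refl a ⟩
      0ℚ ∎
    antisym : ∀ x y → x ≢ 0ℚ → y ≢ 0ℚ → R x y + R y x ≡ 0ℚ
    antisym x y x≢0 y≢0 = begin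
      R x y + R y x
        ≡⟨ cong₂ _+_ (evalP-⊙⊕ N a u w x y) (evalP-⊙⊕ N a u w y x) ⟩
      (a * P x y + Q x y) + (a * P y x + Q y x)
        ≡⟨ solve 5 (λ a p₁ p₂ q₁ q₂ → (a :* p₁ :+ q₁) :+ (a :* p₂ :+ q₂) := a :* (p₁ :+ p₂) :+ (q₁ :+ q₂))
             refl a (P x y) (P y x) (Q x y) (Q y x) ⟩
      a * (P x y + P y x) + (Q x y + Q y x)
        ≡⟨ cong₂ (λ p q → a * p + q) (antisym-u x y x≢0 y≢0) (antisym-w x y x≢0 y≢0) ⟩
      a * 0ℚ + 0ℚ
        ≡⟨ solve 1 (λ a → a :* con 0ℚ :+ con 0ℚ := con 0ℚ) refl a ⟩
      0ℚ ∎

  pow-neg1-even : ∀ k → pow (- 1ℚ) (2 ℕ.* k) ≡ 1ℚ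
  pow-neg1-even k = trans (sym (pow-*-assoc (- 1ℚ) 2 k)) (pow-1ℚ k)

  evalP-even : ∀ k v a b → evalP (2 ℕ.* k) v (- a) (- b) ≡ evalP (2 ℕ.* k) v a b
  evalP-even k v a b = cong₂ _*_ (begin
    numer N v (- a) (- b)               ≡⟨ cong₂ (numer N v) (neg≡-1* a) (neg≡-1* b) ⟩
    numer N v (- 1ℚ * a) (- 1ℚ * b)     ≡⟨ homogeneity (numer-homogeneous N v) (- 1ℚ) a b ⟩
    pow (- 1ℚ) N * numer N v a b        ≡⟨ cong (_* numer N v a b) (pow-neg1-even k) ⟩
    1ℚ * numer N v a b                  ≡⟨ *-identityˡ (numer N v a b) ⟩
    numer N v a b                       ∎)
    (cong inv (solve 2 (λ a b → (:- a) :* (:- b) := a :* b) refl a b))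
    where
    open ≡-Reasoning
    N = 2 ℕ.* k
    neg≡-1* : ∀ a → - a ≡ - 1ℚ * a
    neg≡-1* a = solve 1 (λ a → :- a := (:- con 1ℚ) :* a) refl a

  -- Adding the Fay relations at (x, y) and at (−x−y, x) leaves 2 P(−x−y, x) = 0.
  even-weight-evalP[-x-y,x]≡0 : ∀ k v → IsFSh₂ (2 ℕ.* k) v → ∀ x y → x ≢ 0ℚ → y ≢ 0ℚ → x + y ≢ 0ℚ →
                                evalP (2 ℕ.* k) v (- x + - y) x ≡ 0ℚ
  even-weight-evalP[-x-y,x]≡0 k v (fay , antisym) x y x≢0 y≢0 x+y≢0 = p+p≡0⇒p≡0 B (begin
    B + B                         ≡⟨ solve 3 (λ A B C → B :+ B := (A :+ :- C :+ B) :+ (B :+ :- A :+ C)) refl A B C ⟩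
    (A + - C + B) + (B + - A + C) ≡⟨ cong₂ _+_ fay-at-xy fay-at-x′x ⟩
    0ℚ + 0ℚ                       ≡⟨ +-identityʳ 0ℚ ⟩
    0ℚ                            ∎)
    where
    open ≡-Reasoning
    P = evalP (2 ℕ.* k) v
    x′ = - x + - y
    A = P x y
    B = P x′ x
    C = P y x′
    x′≢0 : x′ ≢ 0ℚ
    x′≢0 = -x-y≢0 x y x+y≢0
    x′+x≢0 : x′ + x ≢ 0ℚ
    x′+x≢0 e = -p≢0 y y≢0 (trans (solve 2 (λ x y → :- y := (:- x :+ :- y) :+ x) refl x y) e)
    fay-at-xy : A + - C + B ≡ 0ℚ
    fay-at-xy = trans (cong (λ u → A + u + B) (sym (begin
      P (x + y) (- y)   ≡⟨ cong (λ u → P u (- y)) (solve 2 (λ x y → x :+ y := :- (:- x :+ :- y)) refl x y) ⟩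
      P (- x′) (- y)    ≡⟨ evalP-even k v x′ y ⟩
      P x′ y            ≡⟨ p+q≡0⇒p≡-q (P x′ y) C (antisym x′ y x′≢0 y≢0) ⟩
      - C               ∎)))
      (fay x y x≢0 y≢0 x+y≢0)
    fay-at-x′x : B + - A + C ≡ 0ℚ
    fay-at-x′x = trans (cong₂ (λ u w → B + u + w) (sym (begin
      P (x′ + x) (- x)  ≡⟨ cong (λ u → P u (- x)) (solve 2 (λ x y → (:- x :+ :- y) :+ x := :- y) refl x y) ⟩
      P (- y) (- x)     ≡⟨ evalP-even k v y x ⟩
      P y x             ≡⟨ p+q≡0⇒p≡-q (P y x) A (trans (+-comm (P y x) A) (antisym x y x≢0 y≢0)) ⟩
      - A               ∎))
      (sym (cong (λ u → P u x′) (solve 2 (λ x y → :- (:- x :+ :- y) :+ :- x := y) refl x y))))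
      (fay x′ x x′≢0 x≢0 x′+x≢0)

  even-weight-evalP≡0 : ∀ k v → IsFSh₂ (2 ℕ.* k) v → ∀ a b → a ≢ 0ℚ → b ≢ 0ℚ → a + b ≢ 0ℚ →
                        evalP (2 ℕ.* k) v a b ≡ 0ℚ
  even-weight-evalP≡0 k v v∈FSh₂ a b a≢0 b≢0 a+b≢0 = trans
    (cong (λ u → evalP (2 ℕ.* k) v u b) (solve 2 (λ a b → a := :- b :+ :- (:- a :+ :- b)) refl a b))
    (even-weight-evalP[-x-y,x]≡0 k v v∈FSh₂ b (- a + - b) b≢0 (-x-y≢0 a b a+b≢0)
      (λ e → -p≢0 a a≢0 (trans (solve 2 (λ a b → :- a := b :+ (:- a :+ :- b)) refl a b) e)))

  even-weight-vanishes : ∀ k v → IsFSh₂ (2 ℕ.* k) v → v ≡ zeroV _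
  even-weight-vanishes k v v∈FSh₂ = ray-zero⇒zeroV v 0ℚ λ t 0<t → begin
    eval (toList v) t         ≡⟨ sym (numer-dehomogenise (2 ℕ.* k) v t) ⟩
    numer (2 ℕ.* k) v t 1ℚ    ≡⟨ p*q≡0⇒p≡0 _ (inv (t * 1ℚ)) (inv≢0 (t * 1ℚ) (p*q≢0 t 1ℚ (0<p⇒p≢0 0<t) 1≢0))
                                   (even-weight-evalP≡0 k v v∈FSh₂ t 1ℚ (0<p⇒p≢0 0<t) 1≢0
                                     (0<p⇒p≢0 (<-trans 0<t (p<p+1 t)))) ⟩
    0ℚ                        ∎
    where open ≡-Reasoning

  vanishesBelow⇒≡replicate++ : ∀ {n} (v : Vec ℚ n) s → s ℕ.≤ n → VanishesBelow s v →
                               ∃ λ l → toList v ≡ replicate s 0ℚ ++ l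
  vanishesBelow⇒≡replicate++ v       zero    _         _     = toList v , refl
  vanishesBelow⇒≡replicate++ (c ∷ v) (suc s) (s≤s s≤n) v-low
    with vanishesBelow⇒≡replicate++ v s s≤n (λ i i<s → v-low (fsuc i) (s≤s i<s))
  ... | l , v≡0ˢ++l = l , cong₂ _∷_ (v-low fzero (s≤s z≤n)) v≡0ˢ++l

  -- G(t) = g(1,t) = −g(t,1) has degree < 2m + 2, but is divisible by tᵐ⁺¹ since g is by xᵐ⁺¹,
  -- by t − 1 since g(1,1) = 0, and by (t + 1)ᵐ by the Fay relation at (t, 1); so G = 0.
  module LowOrderVanishing {N m : ℕ} (N≤3m+2 : N ℕ.≤ suc m ℕ.+ (suc m ℕ.+ m)) (m≤N : m ℕ.≤ N)
                           (v : Vec ℚ (suc N)) (v∈FSh₂ : IsFSh₂ N v) (v-low : VanishesBelow (suc m) v) where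

    g : ℚ → ℚ → ℚ
    g = numer N v

    d : ℕ
    d = N ∸ suc m

    split : ∃ λ l → toList v ≡ replicate (suc m) 0ℚ ++ l
    split = vanishesBelow⇒≡replicate++ v (suc m) (s≤s m≤N) v-low

    h : ℚ → ℚ → ℚ
    h = evalHom (proj₁ split) d

    g≡xᵐ⁺¹h : ∀ x y → g x y ≡ pow x (suc m) * h x y
    g≡xᵐ⁺¹h x y = begin
      g x y                                          ≡⟨ numer≡evalHom N v x y ⟩
      evalHom (toList v) N x y                       ≡⟨ cong (λ l → evalHom l N x y) (proj₂ split) ⟩
      evalHom (replicate (suc m) 0ℚ ++ proj₁ split) N x y ≡⟨ evalHom-replicate (suc m) (proj₁ split) N x y ⟩
      pow x (suc m) * h x y                          ∎
      where open ≡-Reasoning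

    antisym : Antisymmetric g
    antisym = IsFSh₂⇒antisymmetric N v v∈FSh₂

    G : ℚ → ℚ
    G t = h 1ℚ t

    G≡g1t : ∀ t → G t ≡ g 1ℚ t
    G≡g1t t = sym (trans (g≡xᵐ⁺¹h 1ℚ t) (trans (cong (_* G t) (pow-1ℚ (suc m))) (*-identityˡ (G t))))

    G<2m+2 : Polynomial< (suc m ℕ.+ suc m) G
    G<2m+2 = polynomial<-mono d<2m+2 (evalHom-polynomial< (proj₁ split) d)
      where
      d<2m+2 : suc d ℕ.≤ suc m ℕ.+ suc m
      d<2m+2 = subst (suc d ℕ.≤_) (sym (ℕ.+-suc (suc m) m)) (s≤s (ℕ.m≤n+o⇒m∸n≤o N (suc m) N≤3m+2))

    t≢0 : ∀ {t} → 1ℚ < t → t ≢ 0ℚ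
    t≢0 1<t = 0<p⇒p≢0 (<-trans (positive⁻¹ 1ℚ) 1<t)

    t+1≢0 : ∀ {t} → 1ℚ < t → t + 1ℚ ≢ 0ℚ
    t+1≢0 1<t = t≢0 (<-trans 1<t (p<p+1 _))

    G≡-gt1 : ∀ t → 1ℚ < t → G t ≡ - g t 1ℚ
    G≡-gt1 t 1<t = trans (G≡g1t t) (p+q≡0⇒p≡-q (g 1ℚ t) (g t 1ℚ) (antisym 1ℚ t 1≢0 (t≢0 1<t)))

    factor-tᵐ⁺¹ : ∃ λ G₁ → Polynomial< (suc m) G₁ × (∀ t → G t ≡ pow (t - 0ℚ) (suc m) * G₁ t)
    factor-tᵐ⁺¹ = factor-power (suc m) 0ℚ 1ℚ (<⇒≤ (positive⁻¹ 1ℚ)) (polynomial-const 1ℚ)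
      (polynomial-neg (evalHom-polynomial (proj₁ split) d polynomial-id (polynomial-const 1ℚ))) 1≢0 G<2m+2
      λ t 1<t → begin
        1ℚ * G t                       ≡⟨ *-identityˡ (G t) ⟩
        G t                            ≡⟨ G≡-gt1 t 1<t ⟩
        - g t 1ℚ                       ≡⟨ cong -_ (g≡xᵐ⁺¹h t 1ℚ) ⟩
        - (pow t (suc m) * h t 1ℚ)     ≡⟨ neg-distribʳ-* (pow t (suc m)) (h t 1ℚ) ⟩
        pow t (suc m) * - h t 1ℚ       ≡⟨ cong (λ u → pow u (suc m) * - h t 1ℚ) (sym (+-identityʳ t)) ⟩
        pow (t - 0ℚ) (suc m) * - h t 1ℚ ∎
      where open ≡-Reasoning

    G₁ : ℚ → ℚ
    G₁ = proj₁ factor-tᵐ⁺¹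

    G≡tᵐ⁺¹G₁ : ∀ t → G t ≡ pow (t - 0ℚ) (suc m) * G₁ t
    G≡tᵐ⁺¹G₁ = proj₂ (proj₂ factor-tᵐ⁺¹)

    G₁[1]≡0 : G₁ 1ℚ ≡ 0ℚ
    G₁[1]≡0 = p*q≡0⇒q≡0 (pow (1ℚ - 0ℚ) (suc m)) (G₁ 1ℚ) (pow≢0 (1ℚ - 0ℚ) (suc m) (λ ()))
      (trans (sym (G≡tᵐ⁺¹G₁ 1ℚ)) (trans (G≡g1t 1ℚ) (p+p≡0⇒p≡0 (g 1ℚ 1ℚ) (antisym 1ℚ 1ℚ 1≢0 1≢0))))

    factor-t-1 : ∃ λ G₂ → Polynomial< m G₂ × (∀ t → G₁ t ≡ (t - 1ℚ) * G₂ t)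
    factor-t-1 = factor-root 1ℚ (proj₁ (proj₂ factor-tᵐ⁺¹)) G₁[1]≡0

    G₂ : ℚ → ℚ
    G₂ = proj₁ factor-t-1

    G₁≡[t-1]G₂ : ∀ t → G₁ t ≡ (t - 1ℚ) * G₂ t
    G₁≡[t-1]G₂ = proj₂ (proj₂ factor-t-1)

    K : ℚ → ℚ
    K t = t * h (t + 1ℚ) (- 1ℚ) + pow (- 1ℚ) (suc m) * h (- t + - 1ℚ) t

    K-poly : Polynomial K
    K-poly = polynomial-+
      (polynomial-* polynomial-id
        (evalHom-polynomial l d (polynomial-+ polynomial-id (polynomial-const 1ℚ)) (polynomial-const (- 1ℚ))))
      (polynomial-* (polynomial-const (pow (- 1ℚ) (suc m)))
        (evalHom-polynomial l d (polynomial-+ (polynomial-neg polynomial-id) (polynomial-const (- 1ℚ))) polynomial-id))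
      where l = proj₁ split

    gt1≡[t+1]ᵐK : ∀ t → 1ℚ < t → g t 1ℚ ≡ pow (t + 1ℚ) m * K t
    gt1≡[t+1]ᵐK t 1<t = *-cancelˡ-≢0 (t + 1ℚ) (g t 1ℚ) (pow (t + 1ℚ) m * K t) (t+1≢0 1<t) (begin
      (t + 1ℚ) * g t 1ℚ
        ≡⟨ IsFSh₂⇒fay N v v∈FSh₂ t 1ℚ (t≢0 1<t) 1≢0 (t+1≢0 1<t) ⟩
      t * g (t + 1ℚ) (- 1ℚ) + 1ℚ * g (- t + - 1ℚ) t
        ≡⟨ cong₂ (λ u w → t * u + 1ℚ * w) (g≡xᵐ⁺¹h (t + 1ℚ) (- 1ℚ)) (g≡xᵐ⁺¹h (- t + - 1ℚ) t) ⟩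
      t * (pow (t + 1ℚ) (suc m) * a) + 1ℚ * (pow (- t + - 1ℚ) (suc m) * b)
        ≡⟨ cong (λ u → t * (pow (t + 1ℚ) (suc m) * a) + 1ℚ * (u * b)) [-t-1]ᵐ⁺¹ ⟩
      t * ((t + 1ℚ) * p * a) + 1ℚ * (q * ((t + 1ℚ) * p) * b)
        ≡⟨ solve 5 (λ t p q a b → t :* ((t :+ con 1ℚ) :* p :* a) :+ con 1ℚ :* (q :* ((t :+ con 1ℚ) :* p) :* b)
                                  := (t :+ con 1ℚ) :* (p :* (t :* a :+ q :* b))) refl t p q a b ⟩
      (t + 1ℚ) * (pow (t + 1ℚ) m * K t) ∎)
      where
      open ≡-Reasoning
      a = h (t + 1ℚ) (- 1ℚ)
      b = h (- t + - 1ℚ) t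
      p = pow (t + 1ℚ) m
      q = pow (- 1ℚ) (suc m)
      [-t-1]ᵐ⁺¹ : pow (- t + - 1ℚ) (suc m) ≡ q * pow (t + 1ℚ) (suc m)
      [-t-1]ᵐ⁺¹ = trans
        (cong (λ u → pow u (suc m)) (solve 1 (λ t → :- t :+ :- con 1ℚ := (:- con 1ℚ) :* (t :+ con 1ℚ)) refl t))
        (pow-distribʳ-* (- 1ℚ) (t + 1ℚ) (suc m))

    A : ℚ → ℚ
    A t = pow (t - 0ℚ) (suc m) * (t - 1ℚ)

    A-poly : Polynomial A
    A-poly = polynomial-* (polynomial-pow (suc m) (polynomial-+ polynomial-id (polynomial-const (- 0ℚ))))
                          (polynomial-+ polynomial-id (polynomial-const (- 1ℚ)))

    A[-1]≢0 : A (- 1ℚ) ≢ 0ℚ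
    A[-1]≢0 = p*q≢0 _ _ (pow≢0 (- 1ℚ - 0ℚ) (suc m) (λ ())) (λ ())

    AG₂≡-[t+1]ᵐK : ∀ t → 1ℚ < t → A t * G₂ t ≡ pow (t - - 1ℚ) m * - K t
    AG₂≡-[t+1]ᵐK t 1<t = begin
      A t * G₂ t                                ≡⟨ *-assoc (pow (t - 0ℚ) (suc m)) (t - 1ℚ) (G₂ t) ⟩
      pow (t - 0ℚ) (suc m) * ((t - 1ℚ) * G₂ t)  ≡⟨ cong (pow (t - 0ℚ) (suc m) *_) (sym (G₁≡[t-1]G₂ t)) ⟩
      pow (t - 0ℚ) (suc m) * G₁ t               ≡⟨ sym (G≡tᵐ⁺¹G₁ t) ⟩
      G t                                       ≡⟨ G≡-gt1 t 1<t ⟩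
      - g t 1ℚ                                  ≡⟨ cong -_ (gt1≡[t+1]ᵐK t 1<t) ⟩
      - (pow (t + 1ℚ) m * K t)                  ≡⟨ neg-distribʳ-* (pow (t + 1ℚ) m) (K t) ⟩
      pow (t - - 1ℚ) m * - K t                  ∎
      where open ≡-Reasoning

    factor-[t+1]ᵐ : ∃ λ G₃ → Polynomial< 0 G₃ × (∀ t → G₂ t ≡ pow (t - - 1ℚ) m * G₃ t)
    factor-[t+1]ᵐ = factor-power m (- 1ℚ) 1ℚ (<⇒≤ (<-trans (negative⁻¹ (- 1ℚ)) (positive⁻¹ 1ℚ)))
      A-poly (polynomial-neg K-poly) A[-1]≢0
      (subst (λ n → Polynomial< n G₂) (sym (ℕ.+-identityʳ m)) (proj₁ (proj₂ factor-t-1))) AG₂≡-[t+1]ᵐK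

    G₂≡0 : ∀ t → G₂ t ≡ 0ℚ
    G₂≡0 t = trans (proj₂ (proj₂ factor-[t+1]ᵐ) t)
      (trans (cong (pow (t - - 1ℚ) m *_) (polynomial<0⇒zero (proj₁ (proj₂ factor-[t+1]ᵐ)) t)) (*-zeroʳ (pow (t - - 1ℚ) m)))

    G≡0 : ∀ t → G t ≡ 0ℚ
    G≡0 t = begin
      G t                                       ≡⟨ G≡tᵐ⁺¹G₁ t ⟩
      pow (t - 0ℚ) (suc m) * G₁ t               ≡⟨ cong (pow (t - 0ℚ) (suc m) *_) (G₁≡[t-1]G₂ t) ⟩
      pow (t - 0ℚ) (suc m) * ((t - 1ℚ) * G₂ t)  ≡⟨ cong (λ u → pow (t - 0ℚ) (suc m) * ((t - 1ℚ) * u)) (G₂≡0 t) ⟩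
      pow (t - 0ℚ) (suc m) * ((t - 1ℚ) * 0ℚ)    ≡⟨ solve 2 (λ a b → a :* (b :* con 0ℚ) := con 0ℚ) refl (pow (t - 0ℚ) (suc m)) (t - 1ℚ) ⟩
      0ℚ                                        ∎
      where open ≡-Reasoning

    v≡0 : v ≡ zeroV (suc N)
    v≡0 = ray-zero⇒zeroV v 1ℚ λ t 1<t → begin
      eval (toList v) t   ≡⟨ sym (numer-dehomogenise N v t) ⟩
      g t 1ℚ              ≡⟨ neg-injective (trans (sym (G≡-gt1 t 1<t)) (G≡0 t)) ⟩
      0ℚ                  ∎
      where open ≡-Reasoning

  Invariant : (ℚ → ℚ → ℚ) → Set
  Invariant I = ∀ x y → I (x + y) (- y) ≡ I x y × I (- x + - y) x ≡ I x y × I y x ≡ I x y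

  invariant-* : ∀ {I J} → Invariant I → Invariant J → Invariant (λ x y → I x y * J x y)
  invariant-* I-inv J-inv x y with I-inv x y | J-inv x y
  ... | i₁ , i₂ , i₃ | j₁ , j₂ , j₃ = cong₂ _*_ i₁ j₁ , cong₂ _*_ i₂ j₂ , cong₂ _*_ i₃ j₃

  invariant-pow : ∀ {I} k → Invariant I → Invariant (λ x y → pow (I x y) k)
  invariant-pow k I-inv x y with I-inv x y
  ... | i₁ , i₂ , i₃ = cong (λ u → pow u k) i₁ , cong (λ u → pow u k) i₂ , cong (λ u → pow u k) i₃

  fay-invariant-* : ∀ {I g} → Invariant I → FayRelation g → FayRelation (λ x y → I x y * g x y)
  fay-invariant-* {I} {g} I-inv fay x y x≢0 y≢0 x+y≢0 with I-inv x y
  ... | i₁ , i₂ , _ = begin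
    (x + y) * (I x y * g x y)                           ≡⟨ solve 3 (λ s i u → s :* (i :* u) := i :* (s :* u)) refl (x + y) (I x y) (g x y) ⟩
    I x y * ((x + y) * g x y)                           ≡⟨ cong (I x y *_) (fay x y x≢0 y≢0 x+y≢0) ⟩
    I x y * (x * g (x + y) (- y) + y * g (- x + - y) x)
      ≡⟨ solve 5 (λ i x y u w → i :* (x :* u :+ y :* w) := x :* (i :* u) :+ y :* (i :* w))
           refl (I x y) x y (g (x + y) (- y)) (g (- x + - y) x) ⟩
    x * (I x y * g (x + y) (- y)) + y * (I x y * g (- x + - y) x)
      ≡⟨ cong₂ (λ u w → x * (u * g (x + y) (- y)) + y * (w * g (- x + - y) x)) (sym i₁) (sym i₂) ⟩
    x * (I (x + y) (- y) * g (x + y) (- y)) + y * (I (- x + - y) x * g (- x + - y) x) ∎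
    where open ≡-Reasoning

  antisymmetric-invariant-* : ∀ {I g} → Invariant I → Antisymmetric g → Antisymmetric (λ x y → I x y * g x y)
  antisymmetric-invariant-* {I} {g} I-inv antisym x y x≢0 y≢0 = begin
    I x y * g x y + I y x * g y x   ≡⟨ cong (λ u → I x y * g x y + u * g y x) (proj₂ (proj₂ (I-inv x y))) ⟩
    I x y * g x y + I x y * g y x   ≡⟨ sym (*-distribˡ-+ (I x y) (g x y) (g y x)) ⟩
    I x y * (g x y + g y x)         ≡⟨ cong (I x y *_) (antisym x y x≢0 y≢0) ⟩
    I x y * 0ℚ                      ≡⟨ *-zeroʳ (I x y) ⟩
    0ℚ                              ∎
    where open ≡-Reasoning

  W Q : ℚ → ℚ → ℚ
  W x y = x * y * (x + y) * (x * y * (x + y))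
  Q x y = x * x + x * y + y * y

  B : Parity → ℚ → ℚ → ℚ
  B 0ℙ x y = y - x
  B 1ℙ x y = x * y * (y - x)

  bit : Parity → ℕ
  bit 0ℙ = 0
  bit 1ℙ = 1

  W-invariant : Invariant W
  W-invariant x y =
    solve 2 (λ x y → (x :+ y) :* (:- y) :* ((x :+ y) :+ :- y) :* ((x :+ y) :* (:- y) :* ((x :+ y) :+ :- y))
                     := x :* y :* (x :+ y) :* (x :* y :* (x :+ y))) refl x y ,
    solve 2 (λ x y → (:- x :+ :- y) :* x :* ((:- x :+ :- y) :+ x) :* ((:- x :+ :- y) :* x :* ((:- x :+ :- y) :+ x))
                     := x :* y :* (x :+ y) :* (x :* y :* (x :+ y))) refl x y ,
    solve 2 (λ x y → y :* x :* (y :+ x) :* (y :* x :* (y :+ x)) := x :* y :* (x :+ y) :* (x :* y :* (x :+ y))) refl x y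

  Q-invariant : Invariant Q
  Q-invariant x y =
    solve 2 (λ x y → (x :+ y) :* (x :+ y) :+ (x :+ y) :* (:- y) :+ (:- y) :* (:- y) := x :* x :+ x :* y :+ y :* y) refl x y ,
    solve 2 (λ x y → (:- x :+ :- y) :* (:- x :+ :- y) :+ (:- x :+ :- y) :* x :+ x :* x := x :* x :+ x :* y :+ y :* y) refl x y ,
    solve 2 (λ x y → y :* y :+ y :* x :+ x :* x := x :* x :+ x :* y :+ y :* y) refl x y

  B-fay : ∀ r → FayRelation (B r)
  B-fay 0ℙ x y _ _ _ = solve 2 (λ x y → (x :+ y) :* (y :- x) := x :* ((:- y) :- (x :+ y)) :+ y :* (x :- (:- x :+ :- y))) refl x y
  B-fay 1ℙ x y _ _ _ = solve 2 (λ x y → (x :+ y) :* (x :* y :* (y :- x))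
    := x :* ((x :+ y) :* (:- y) :* ((:- y) :- (x :+ y))) :+ y :* ((:- x :+ :- y) :* x :* (x :- (:- x :+ :- y)))) refl x y

  B-antisymmetric : ∀ r → Antisymmetric (B r)
  B-antisymmetric 0ℙ x y _ _ = solve 2 (λ x y → (y :- x) :+ (x :- y) := con 0ℚ) refl x y
  B-antisymmetric 1ℙ x y _ _ = solve 2 (λ x y → x :* y :* (y :- x) :+ y :* x :* (x :- y) := con 0ℚ) refl x y

  W-homogeneous : Homogeneous 6 W
  W-homogeneous = homogeneous λ l x y → solve 3 (λ l x y →
    l :* x :* (l :* y) :* (l :* x :+ l :* y) :* (l :* x :* (l :* y) :* (l :* x :+ l :* y))
    := (l :* (l :* (l :* (l :* (l :* (l :* con 1ℚ)))))) :* (x :* y :* (x :+ y) :* (x :* y :* (x :+ y)))) refl l x y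

  Q-homogeneous : Homogeneous 2 Q
  Q-homogeneous = homogeneous λ l x y → solve 3 (λ l x y → l :* x :* (l :* x) :+ l :* x :* (l :* y) :+ l :* y :* (l :* y)
    := (l :* (l :* con 1ℚ)) :* (x :* x :+ x :* y :+ y :* y)) refl l x y

  B-homogeneous : ∀ r → Homogeneous (suc (2 ℕ.* bit r)) (B r)
  B-homogeneous 0ℙ = homogeneous λ l x y → solve 3 (λ l x y → l :* y :- l :* x := (l :* con 1ℚ) :* (y :- x)) refl l x y
  B-homogeneous 1ℙ = homogeneous λ l x y → solve 3 (λ l x y → l :* x :* (l :* y) :* (l :* y :- l :* x)
    := (l :* (l :* (l :* con 1ℚ))) :* (x :* y :* (y :- x))) refl l x y

  fay-cong : ∀ {g h} → (∀ x y → y ≢ 0ℚ → g x y ≡ h x y) → FayRelation h → FayRelation g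
  fay-cong {g} {h} g≡h fay x y x≢0 y≢0 x+y≢0 = begin
    (x + y) * g x y                                     ≡⟨ cong ((x + y) *_) (g≡h x y y≢0) ⟩
    (x + y) * h x y                                     ≡⟨ fay x y x≢0 y≢0 x+y≢0 ⟩
    x * h (x + y) (- y) + y * h (- x + - y) x
      ≡⟨ sym (cong₂ (λ u w → x * u + y * w) (g≡h (x + y) (- y) (-p≢0 y y≢0)) (g≡h (- x + - y) x x≢0)) ⟩
    x * g (x + y) (- y) + y * g (- x + - y) x           ∎
    where open ≡-Reasoning

  antisymmetric-cong : ∀ {g h} → (∀ x y → y ≢ 0ℚ → g x y ≡ h x y) → Antisymmetric h → Antisymmetric g
  antisymmetric-cong g≡h antisym x y x≢0 y≢0 = trans (cong₂ _+_ (g≡h x y y≢0) (g≡h y x x≢0)) (antisym x y x≢0 y≢0)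

  solution : ℕ → Parity → ℕ → ℚ → ℚ → ℚ
  solution b r a x y = pow (W x y) b * pow (Q x y) a * B r x y

  degree : ℕ → Parity → ℕ → ℕ
  degree b r a = b ℕ.* 6 ℕ.+ a ℕ.* 2 ℕ.+ suc (2 ℕ.* bit r)

  WᵇQᵃ-invariant : ∀ b a → Invariant (λ x y → pow (W x y) b * pow (Q x y) a)
  WᵇQᵃ-invariant b a = invariant-* (invariant-pow b W-invariant) (invariant-pow a Q-invariant)

  solution-homogeneous : ∀ b r a → Homogeneous (degree b r a) (solution b r a)
  solution-homogeneous b r a =
    homogeneous-* (homogeneous-* (homogeneous-pow b W-homogeneous) (homogeneous-pow a Q-homogeneous)) (B-homogeneous r)

  Wₚ Qₚ : List ℚ
  Wₚ = 0ℚ ∷ 0ℚ ∷ 1ℚ ∷ 1ℚ + 1ℚ ∷ 1ℚ ∷ []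
  Qₚ = 1ℚ ∷ 1ℚ ∷ 1ℚ ∷ []

  Bₚ : Parity → List ℚ
  Bₚ 0ℙ = 1ℚ ∷ - 1ℚ ∷ []
  Bₚ 1ℙ = 0ℚ ∷ 1ℚ ∷ - 1ℚ ∷ []

  solutionₚ : ℕ → Parity → ℕ → List ℚ
  solutionₚ b r a = Wₚ ^ₚ b *ₚ Qₚ ^ₚ a *ₚ Bₚ r

  eval-solutionₚ : ∀ b r a t → eval (solutionₚ b r a) t ≡ solution b r a t 1ℚ
  eval-solutionₚ b r a t = begin
    eval (Wₚ ^ₚ b *ₚ Qₚ ^ₚ a *ₚ Bₚ r) t
      ≡⟨ eval-*ₚ (Wₚ ^ₚ b *ₚ Qₚ ^ₚ a) (Bₚ r) t ⟩
    eval (Wₚ ^ₚ b *ₚ Qₚ ^ₚ a) t * eval (Bₚ r) t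
      ≡⟨ cong (_* eval (Bₚ r) t) (eval-*ₚ (Wₚ ^ₚ b) (Qₚ ^ₚ a) t) ⟩
    eval (Wₚ ^ₚ b) t * eval (Qₚ ^ₚ a) t * eval (Bₚ r) t
      ≡⟨ cong₂ (λ u w → u * w * eval (Bₚ r) t) (eval-^ₚ Wₚ b t) (eval-^ₚ Qₚ a t) ⟩
    pow (eval Wₚ t) b * pow (eval Qₚ t) a * eval (Bₚ r) t
      ≡⟨ cong₂ (λ u w → pow u b * pow w a * eval (Bₚ r) t) eval-Wₚ eval-Qₚ ⟩
    pow (W t 1ℚ) b * pow (Q t 1ℚ) a * eval (Bₚ r) t
      ≡⟨ cong (pow (W t 1ℚ) b * pow (Q t 1ℚ) a *_) (eval-Bₚ r) ⟩
    solution b r a t 1ℚ ∎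
    where
    open ≡-Reasoning
    eval-Wₚ : eval Wₚ t ≡ W t 1ℚ
    eval-Wₚ = solve 1 (λ t → con 0ℚ :+ t :* (con 0ℚ :+ t :* (con 1ℚ :+ t :* ((con 1ℚ :+ con 1ℚ) :+ t :* (con 1ℚ :+ t :* con 0ℚ))))
                             := t :* con 1ℚ :* (t :+ con 1ℚ) :* (t :* con 1ℚ :* (t :+ con 1ℚ))) refl t
    eval-Qₚ : eval Qₚ t ≡ Q t 1ℚ
    eval-Qₚ = solve 1 (λ t → con 1ℚ :+ t :* (con 1ℚ :+ t :* (con 1ℚ :+ t :* con 0ℚ)) := t :* t :+ t :* con 1ℚ :+ con 1ℚ :* con 1ℚ) refl t
    eval-Bₚ : ∀ r → eval (Bₚ r) t ≡ B r t 1ℚ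
    eval-Bₚ 0ℙ = solve 1 (λ t → con 1ℚ :+ t :* (:- con 1ℚ :+ t :* con 0ℚ) := con 1ℚ :- t) refl t
    eval-Bₚ 1ℙ = solve 1 (λ t → con 0ℚ :+ t :* (con 1ℚ :+ t :* (:- con 1ℚ :+ t :* con 0ℚ)) := t :* con 1ℚ :* (con 1ℚ :- t)) refl t

  length-solutionₚ : ∀ b r a → length (solutionₚ b r a) ℕ.≤ suc (degree b r a)
  length-solutionₚ b r a = ℕ.≤-trans
    (length-*ₚ (Wₚ ^ₚ b *ₚ Qₚ ^ₚ a) (Bₚ r)
      (length-*ₚ (Wₚ ^ₚ b) (Qₚ ^ₚ a) (length-^ₚ Wₚ b ℕ.≤-refl) (length-^ₚ Qₚ a ℕ.≤-refl)) (length-Bₚ r))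
    (s≤s (ℕ.+-mono-≤ (ℕ.+-monoˡ-≤ (a ℕ.* 2) (ℕ.*-monoʳ-≤ b (s≤s (s≤s (s≤s (s≤s z≤n)))))) (bit≤2bit r)))
    where
    length-Bₚ : ∀ r → length (Bₚ r) ℕ.≤ suc (suc (bit r))
    length-Bₚ 0ℙ = ℕ.≤-refl
    length-Bₚ 1ℙ = ℕ.≤-refl
    bit≤2bit : ∀ r → suc (bit r) ℕ.≤ suc (2 ℕ.* bit r)
    bit≤2bit 0ℙ = ℕ.≤-refl
    bit≤2bit 1ℙ = s≤s (s≤s z≤n)

  solutionₚ-lowOrderTerm : ∀ b r a → LowOrderTerm (solutionₚ b r a) (b ℕ.* 2 ℕ.+ a ℕ.* 0 ℕ.+ bit r) 1ℚ
  solutionₚ-lowOrderTerm b r a = subst (LowOrderTerm (solutionₚ b r a) _) coefficient≡1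
    (lowOrderTerm-*ₚ (Wₚ ^ₚ b *ₚ Qₚ ^ₚ a) (Bₚ r)
      (lowOrderTerm-*ₚ (Wₚ ^ₚ b) (Qₚ ^ₚ a) (lowOrderTerm-^ₚ Wₚ b Wₚ-term) (lowOrderTerm-^ₚ Qₚ a ((λ _ ()) , refl)))
      (Bₚ-term r))
    where
    Wₚ-term : LowOrderTerm Wₚ 2 1ℚ
    Wₚ-term = (λ { 0 _ → refl ; 1 _ → refl ; (suc (suc i)) (s≤s (s≤s ())) }) , refl
    Bₚ-term : ∀ r → LowOrderTerm (Bₚ r) (bit r) 1ℚ
    Bₚ-term 0ℙ = (λ _ ()) , refl
    Bₚ-term 1ℙ = (λ { 0 _ → refl ; (suc i) (s≤s ()) }) , refl
    coefficient≡1 : pow 1ℚ b * pow 1ℚ a * 1ℚ ≡ 1ℚ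
    coefficient≡1 = cong₂ (λ u w → u * w * 1ℚ) (pow-1ℚ b) (pow-1ℚ a)

  solution∈FSh₂ : ∀ N b r a → N ≡ degree b r a → IsFSh₂ N (pad (suc N) (solutionₚ b r a))
  solution∈FSh₂ N b r a refl = fay∧antisymmetric⇒IsFSh₂ N v
    (fay-cong numer≡solution (fay-invariant-* (WᵇQᵃ-invariant b a) (B-fay r)))
    (antisymmetric-cong numer≡solution (antisymmetric-invariant-* (WᵇQᵃ-invariant b a) (B-antisymmetric r)))
    where
    v = pad (suc N) (solutionₚ b r a)
    numer≡solution : ∀ x y → y ≢ 0ℚ → numer N v x y ≡ solution b r a x y
    numer≡solution = homogeneous-agree (numer-homogeneous N v) (solution-homogeneous b r a) λ t →
      trans (numer-dehomogenise N v t)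
            (trans (eval-pad (suc N) (solutionₚ b r a) t (length-solutionₚ b r a)) (eval-solutionₚ b r a t))

  2⌊n/2⌋+bit≡n : ∀ n → 2 ℕ.* ⌊ n /2⌋ ℕ.+ bit (parity n) ≡ n
  2⌊n/2⌋+bit≡n 0             = refl
  2⌊n/2⌋+bit≡n 1             = refl
  2⌊n/2⌋+bit≡n (suc (suc n)) =
    trans (cong (ℕ._+ bit (parity n)) (ℕ.*-suc 2 ⌊ n /2⌋)) (cong (suc ∘ suc) (2⌊n/2⌋+bit≡n n))

  W-exponent : ℕ → ℕ
  W-exponent j = ⌊ j /2⌋

  Q-exponent : ℕ → ℕ → ℕ
  Q-exponent k j = k ∸ (j ℕ.+ ⌊ j /2⌋)

  -- j = 2b + r, and 2(j + b) + r = 3j ≤ 2k + 1 leaves a = k − j − b ≥ 0 for the exponent of Q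
  solution-indices : ∀ k j → j ℕ.* 3 ℕ.≤ 2 ℕ.* k ℕ.+ 1 →
    2 ℕ.* k ℕ.+ 1 ≡ degree (W-exponent j) (parity j) (Q-exponent k j) ×
    W-exponent j ℕ.* 2 ℕ.+ Q-exponent k j ℕ.* 0 ℕ.+ bit (parity j) ≡ j
  solution-indices k j 3j≤2k+1 = 2k+1≡degree , order≡j
    where
    b = ⌊ j /2⌋
    r = bit (parity j)
    a = Q-exponent k j
    2[j+b]+r≡3j : 2 ℕ.* (j ℕ.+ b) ℕ.+ r ≡ j ℕ.* 3
    2[j+b]+r≡3j = subst (λ J → 2 ℕ.* (J ℕ.+ b) ℕ.+ r ≡ J ℕ.* 3) (2⌊n/2⌋+bit≡n j) (lemma b r)
      where
      lemma : ∀ b r → 2 ℕ.* ((2 ℕ.* b ℕ.+ r) ℕ.+ b) ℕ.+ r ≡ (2 ℕ.* b ℕ.+ r) ℕ.* 3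
      lemma = solve-∀
    j+b≤k : j ℕ.+ b ℕ.≤ k
    j+b≤k = ℕ.≤-pred (ℕ.*-cancelˡ-< 2 (j ℕ.+ b) (suc k) (ℕ.≤-trans
      (s≤s (ℕ.≤-trans (ℕ.m≤m+n (2 ℕ.* (j ℕ.+ b)) r) (subst (ℕ._≤ 2 ℕ.* k ℕ.+ 1) (sym 2[j+b]+r≡3j) 3j≤2k+1)))
      (ℕ.≤-reflexive (lemma k))))
      where
      lemma : ∀ k → suc (2 ℕ.* k ℕ.+ 1) ≡ 2 ℕ.* suc k
      lemma = solve-∀
    2k+1≡degree : 2 ℕ.* k ℕ.+ 1 ≡ degree b (parity j) a
    2k+1≡degree = begin
      2 ℕ.* k ℕ.+ 1                                 ≡⟨ cong (λ k → 2 ℕ.* k ℕ.+ 1) (sym (ℕ.m∸n+n≡m j+b≤k)) ⟩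
      2 ℕ.* (a ℕ.+ (j ℕ.+ b)) ℕ.+ 1                 ≡⟨ cong (λ J → 2 ℕ.* (a ℕ.+ (J ℕ.+ b)) ℕ.+ 1) (sym (2⌊n/2⌋+bit≡n j)) ⟩
      2 ℕ.* (a ℕ.+ ((2 ℕ.* b ℕ.+ r) ℕ.+ b)) ℕ.+ 1   ≡⟨ lemma a b r ⟩
      b ℕ.* 6 ℕ.+ a ℕ.* 2 ℕ.+ suc (2 ℕ.* r)         ∎
      where
      open ≡-Reasoning
      lemma : ∀ a b r → 2 ℕ.* (a ℕ.+ ((2 ℕ.* b ℕ.+ r) ℕ.+ b)) ℕ.+ 1 ≡ b ℕ.* 6 ℕ.+ a ℕ.* 2 ℕ.+ suc (2 ℕ.* r)
      lemma = solve-∀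
    order≡j : b ℕ.* 2 ℕ.+ a ℕ.* 0 ℕ.+ r ≡ j
    order≡j = trans (lemma b a r) (2⌊n/2⌋+bit≡n j)
      where
      lemma : ∀ b a r → b ℕ.* 2 ℕ.+ a ℕ.* 0 ℕ.+ r ≡ 2 ℕ.* b ℕ.+ r
      lemma = solve-∀

  even-weight-dimension : ∀ k → HasDim (IsFSh₂ (2 ℕ.* k)) 0
  even-weight-dimension k =
    [] , (λ ()) , (λ { [] _ → refl }) , λ v v∈FSh₂ → [] , sym (even-weight-vanishes k v v∈FSh₂)

  module OddWeight (k : ℕ) where

    N : ℕ
    N = 2 ℕ.* k ℕ.+ 1

    m : ℕ
    m = N / 3

    N≤3m+2 : N ℕ.≤ suc m ℕ.+ (suc m ℕ.+ m)
    N≤3m+2 = begin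
      N                      ≡⟨ m≡m%n+[m/n]*n N 3 ⟩
      N % 3 ℕ.+ m ℕ.* 3      ≤⟨ ℕ.+-monoˡ-≤ (m ℕ.* 3) (ℕ.≤-pred (m%n<n N 3)) ⟩
      2 ℕ.+ m ℕ.* 3          ≡⟨ lemma m ⟩
      suc m ℕ.+ (suc m ℕ.+ m) ∎
      where
      open ℕ.≤-Reasoning
      lemma : ∀ m → 2 ℕ.+ m ℕ.* 3 ≡ suc m ℕ.+ (suc m ℕ.+ m)
      lemma = solve-∀

    3j≤N : ∀ j → j ℕ.< suc m → j ℕ.* 3 ℕ.≤ N
    3j≤N j j<1+m = ℕ.≤-trans (ℕ.*-monoˡ-≤ 3 (ℕ.≤-pred j<1+m)) (m/n*n≤m N 3)

    coefficients : ℕ → List ℚ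
    coefficients j = solutionₚ (W-exponent j) (parity j) (Q-exponent k j)

    basisVector : ℕ → Vec ℚ (suc N)
    basisVector j = pad (suc N) (coefficients j)

    lowOrderTerm-at-j : ∀ j → j ℕ.< suc m → LowOrderTerm (coefficients j) j 1ℚ
    lowOrderTerm-at-j j j≤m = subst (λ s → LowOrderTerm (coefficients j) s 1ℚ)
      (proj₂ (solution-indices k j (3j≤N j j≤m))) (solutionₚ-lowOrderTerm (W-exponent j) (parity j) (Q-exponent k j))

    basisVector∈FSh₂ : ∀ j → j ℕ.< suc m → IsFSh₂ N (basisVector j)
    basisVector∈FSh₂ j j≤m =
      solution∈FSh₂ N (W-exponent j) (parity j) (Q-exponent k j) (proj₁ (solution-indices k j (3j≤N j j≤m)))

    basisVector-low : ∀ j → j ℕ.< suc m → VanishesBelow j (basisVector j)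
    basisVector-low j j≤m i i<j =
      trans (lookup-pad (suc N) (coefficients j) i) (proj₁ (lowOrderTerm-at-j j j≤m) (toℕ i) i<j)

    basisVector-pivot : ∀ j → j ℕ.< suc m → ∀ i → toℕ i ≡ j → lookup (basisVector j) i ≡ 1ℚ
    basisVector-pivot j j≤m i refl =
      trans (lookup-pad (suc N) (coefficients j) i) (proj₂ (lowOrderTerm-at-j j j≤m))

    dimension : HasDim (IsFSh₂ N) (m ℕ.+ 1)
    dimension = subst (HasDim (IsFSh₂ N)) (ℕ.+-comm 1 m)
      (Echelon.hasDim (IsFSh₂ N) (IsFSh₂-closed N) (suc m) (s≤s (m/n≤m N 3)) basisVector
        basisVector∈FSh₂ basisVector-low basisVector-pivot
        λ w w∈FSh₂ w-low → LowOrderVanishing.v≡0 N≤3m+2 (m/n≤m N 3) w w∈FSh₂ w-low)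

  odd-weight-dimension : ∀ k → HasDim (IsFSh₂ (2 ℕ.* k ℕ.+ 1)) ((2 ℕ.* k ℕ.+ 1) / 3 ℕ.+ 1)
  odd-weight-dimension = OddWeight.dimension

open import Data.Nat using (ℕ; _+_; _*_; _/_)
open import Data.Product using (_×_; _,_)
open FayShuffle using (even-weight-dimension; odd-weight-dimension)

mainTheorem5 : (k : ℕ) →
    HasDim (IsFSh₂ (2 * k)) 0
    × HasDim (IsFSh₂ (2 * k + 1)) ((2 * k + 1) / 3 + 1)
mainTheorem5 k = even-weight-dimension k , odd-weight-dimension k
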